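{- The substitutions below define algebra morphisms $\Phi_{a\to b,d}:\mathrm{Sol}_{NC}\to\mathrm{Sol}_{NC}'$ and $\Phi_{b,d\to a}:\mathrm{Sol}_{NC}'\to\mathrm{Sol}_{NC}$, and $\Phi_{a\to b,d}\circ\Phi_{b,d\to a}=\mathrm{Id}_{\mathrm{Sol}_{NC}'}$. In particular $\Phi_{a\to b,d}$ is surjective.
   Context: Stable noncommutative polynomials in $A=\{a_1,a_2,\dots\}$: $P=(P_n)_{n\ge0}$, $P_n\in\mathbb{C}\langle a_1,\dots,a_n\rangle$, bounded degree, $P_{n+1}(a_1,\dots,a_n,0)=P_n$. $\mathrm{Sol}_{NC}$ is the set of such $P$ with $P_n|_{a_{i+1}=a_i}=P_{n-2}(a_1,\dots,a_{i-1},a_{i+2},\dots,a_n)$ for all $n\ge2$, $1\le i<n$. Stable noncommutative polynomials in two alphabets: $h=(h_m)_{m\ge0}$ with $h_m$ a polynomial in noncommuting variables $b_1,\dots,b_m,d_1,\dots,d_m$, bounded degree, with $h_{m+1}(b_1,\dots,b_m,0;d_1,\dots,d_m,0)=h_m(b_1,\dots,b_m;d_1,\dots,d_m)$. $\mathrm{Sol}_{NC}'$ is the set of such $h$ with, for all $m\ge1$, $1\le i\le m$: $h_m|_{d_i=0}=h_{m-1}(b_1,\dots,b_{i-1},b_i+b_{i+1},b_{i+2},\dots,b_m;d_1,\dots,d_{i-1},d_{i+1},\dots,d_m)$ if $i<m$ and $h_m|_{d_m=0}=h_{m-1}(b_1,\dots,b_{m-1};d_1,\dots,d_{m-1})$;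 $h_m|_{b_i=0}=h_{m-1}(b_1,\dots,b_{i-1},b_{i+1},\dots,b_m;d_1,\dots,d_{i-2},d_{i-1}+d_i,d_{i+1},\dots,d_m)$ if $i>1$ and $h_m|_{b_1=0}=h_{m-1}(b_2,\dots,b_m;d_2,\dots,d_m)$. $\Phi_{a\to b,d}(P)$ is $h$ with $h_m(b;d)=P_{2m+1}(a_1,\dots,a_{2m+1})$ where $a_{2i+1}=(d_{i+1}+\dots+d_m)-(b_1+\dots+b_i)$ ($0\le i\le m$) and $a_{2i}=(d_i+\dots+d_m)-(b_1+\dots+b_i)$ ($1\le i\le m$). $\Phi_{b,d\to a}(h)$ is $P$ with $P_{2m+1}(a_1,\dots,a_{2m+1})=h_m(b;d)$ where $b_i=a_{2i-1}-a_{2i}$, $d_i=a_{2i}-a_{2i+1}$, and $P_{2m}(a_1,\dots,a_{2m})=P_{2m+1}(a_1,\dots,a_{2m},0)$. -}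

module Defs where

open import Level using (_⊔_)
open import Algebra.Bundles using (CommutativeRing)
open import Data.Nat as ℕ using (ℕ; zero; suc; _≤_; _<_; _∸_; _+_; _<ᵇ_; _≡ᵇ_; ⌊_/2⌋)
open import Data.Bool using (Bool; true; false; if_then_else_)
open import Data.List using (List; []; _∷_; _++_; map; foldr; concatMap; length; applyUpTo)
import Data.List.Properties as LP
open import Data.List.Relation.Unary.Any using (Any)
open import Data.Sum using (_⊎_; inj₁; inj₂; [_,_])
import Data.Sum.Properties as SP
open import Data.Product using (_×_; _,_; ∃)
open import Relation.Nullary using (¬_; does)
open import Relation.Binary.Definitions using (DecidableEquality)
open import Relation.Binary.PropositionalEquality using (_≡_)

BD : Set
BD = ℕ ⊎ ℕ

b : ℕ → BD
b = inj₁

d : ℕ → BD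
d = inj₂

idx : BD → ℕ
idx = [ (λ i → i) , (λ i → i) ]

_≟BD_ : DecidableEquality BD
_≟BD_ = SP.≡-dec ℕ._≟_ ℕ._≟_

evenB : ℕ → Bool
evenB zero = true
evenB (suc zero) = false
evenB (suc (suc n)) = evenB n

-- the list k, k+1, ..., m  (empty if k > m)
range : ℕ → ℕ → List ℕ
range k m = applyUpTo (k +_) (suc m ∸ k)

-- Everything is over a commutative coefficient ring R (the paper uses ℂ).
module WithRing {c ℓ} (R : CommutativeRing c ℓ) where
  open CommutativeRing R using (Carrier; _≈_; 0#; 1#; -_) renaming (_+_ to _+R_; _*_ to _*R_)

  -- Noncommutative polynomials in the alphabet X: finite formal sums of
  -- (word, coefficient); equality is coefficientwise (see _≈P_ below).
  Poly : Set → Set c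
  Poly X = List (List X × Carrier)

  module _ {X : Set} where
    0P : Poly X
    0P = []

    1P : Poly X
    1P = ([] , 1#) ∷ []

    var : X → Poly X
    var x = ((x ∷ []) , 1#) ∷ []

    infixl 6 _+P_ _-P_
    infixl 7 _*P_ _·P_

    _+P_ : Poly X → Poly X → Poly X
    p +P q = p ++ q

    _·P_ : Carrier → Poly X → Poly X
    k ·P p = map (λ (w , a) → (w , k *R a)) p

    -P_ : Poly X → Poly X
    -P p = (- 1#) ·P p

    _-P_ : Poly X → Poly X → Poly X
    p -P q = p +P (-P q)

    _*P_ : Poly X → Poly X → Poly X
    p *P q = concatMap (λ (u , a) → map (λ (v , a') → (u ++ v , a *R a')) q) p

    sumP : (ℕ → Poly X) → ℕ → ℕ → Poly X
    sumP f k m = foldr (λ t acc → f t +P acc) 0P (range k m)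

    coeff : DecidableEquality X → Poly X → List X → Carrier
    coeff dec p w = foldr (λ (u , a) acc → if does (LP.≡-dec dec u w) then a +R acc else acc) 0# p

    Eq : DecidableEquality X → Poly X → Poly X → Set ℓ
    Eq dec p q = ∀ w → coeff dec p w ≈ coeff dec q w

    UsesOnly : DecidableEquality X → (X → Set) → Poly X → Set ℓ
    UsesOnly dec ok p = ∀ w → Any (λ x → ¬ ok x) w → coeff dec p w ≈ 0#

    DegLe : DecidableEquality X → ℕ → Poly X → Set ℓ
    DegLe dec D p = ∀ w → D < length w → coeff dec p w ≈ 0#

    SeqEq : DecidableEquality X → (ℕ → Poly X) → (ℕ → Poly X) → Set ℓ
    SeqEq dec P Q = ∀ n → Eq dec (P n) (Q n)

    _+S_ _*S_ : (ℕ → Poly X) → (ℕ → Poly X) → ℕ → Poly X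
    (P +S Q) n = P n +P Q n
    (P *S Q) n = P n *P Q n

    _·S_ : Carrier → (ℕ → Poly X) → ℕ → Poly X
    (k ·S P) n = k ·P P n

    1S : ℕ → Poly X
    1S n = 1P

  evalMono : {X Y : Set} → (X → Poly Y) → List X → Poly Y
  evalMono σ w = foldr (λ x acc → σ x *P acc) 1P w

  eval : {X Y : Set} → (X → Poly Y) → Poly X → Poly Y
  eval σ p = foldr (λ (w , a) acc → a ·P evalMono σ w +P acc) 0P p

  -- Alphabet A = {a_1, a_2, ...}: letter j : ℕ stands for a_j (a_0 unused)

  _≈A_ : Poly ℕ → Poly ℕ → Set ℓ
  _≈A_ = Eq ℕ._≟_

  _≈SA_ : (ℕ → Poly ℕ) → (ℕ → Poly ℕ) → Set ℓ
  _≈SA_ = SeqEq ℕ._≟_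

  killA : ℕ → ℕ → Poly ℕ
  killA k j = if j ≡ᵇ k then 0P else var j

  StableA : (ℕ → Poly ℕ) → Set ℓ
  StableA P =
      (∀ n → UsesOnly ℕ._≟_ (λ j → 1 ≤ j × j ≤ n) (P n))
    × (∃ λ D → ∀ n → DegLe ℕ._≟_ D (P n))
    × (∀ n → eval (killA (suc n)) (P (suc n)) ≈A P n)

  -- Sol_NC ; the index n of the paper is written 2 + n here
  SolNC : (ℕ → Poly ℕ) → Set ℓ
  SolNC P = StableA P
    × (∀ n i → 1 ≤ i → i < 2 + n →
         eval (λ j → if j ≡ᵇ suc i then var i else var j) (P (2 + n))
           ≈A eval (λ k → if k <ᵇ i then var k else var (2 + k)) (P n))

  _≈BD_ : Poly BD → Poly BD → Set ℓ
  _≈BD_ = Eq _≟BD_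

  _≈SBD_ : (ℕ → Poly BD) → (ℕ → Poly BD) → Set ℓ
  _≈SBD_ = SeqEq _≟BD_

  zeroAt : BD → BD → Poly BD
  zeroAt x y = if does (y ≟BD x) then 0P else var y

  StableBD : (ℕ → Poly BD) → Set ℓ
  StableBD h =
      (∀ m → UsesOnly _≟BD_ (λ x → 1 ≤ idx x × idx x ≤ m) (h m))
    × (∃ λ D → ∀ m → DegLe _≟BD_ D (h m))
    × (∀ m → eval (zeroAt (b (suc m))) (eval (zeroAt (d (suc m))) (h (suc m))) ≈BD h m)

  -- h_{m-1}(b_1,..,b_{i-1}, b_i+b_{i+1}, b_{i+2},..,b_m ; d_1,..,d_{i-1}, d_{i+1},..,d_m)
  σD : ℕ → BD → Poly BD
  σD i (inj₁ k) = if k <ᵇ i then var (b k) else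
                  (if k ≡ᵇ i then var (b i) +P var (b (suc i)) else var (b (suc k)))
  σD i (inj₂ k) = if k <ᵇ i then var (d k) else var (d (suc k))

  -- h_{m-1}(b_1,..,b_{i-1}, b_{i+1},..,b_m ; d_1,..,d_{i-2}, d_{i-1}+d_i, d_{i+1},..,d_m)
  σB : ℕ → BD → Poly BD
  σB i (inj₁ k) = if k <ᵇ i then var (b k) else var (b (suc k))
  σB i (inj₂ k) = if suc k <ᵇ i then var (d k) else
                  (if suc k ≡ᵇ i then var (d k) +P var (d (suc k)) else var (d (suc k)))

  shiftBD : BD → Poly BD
  shiftBD (inj₁ k) = var (b (suc k))
  shiftBD (inj₂ k) = var (d (suc k))

  -- Sol_NC' ; the index m ≥ 1 of the paper is written suc m here
  SolNC' : (ℕ → Poly BD) → Set ℓ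
  SolNC' h = StableBD h
    × (∀ m i → 1 ≤ i → i < suc m →
         eval (zeroAt (d i)) (h (suc m)) ≈BD eval (σD i) (h m))
    × (∀ m → eval (zeroAt (d (suc m))) (h (suc m)) ≈BD h m)
    × (∀ m i → 1 < i → i ≤ suc m →
         eval (zeroAt (b i)) (h (suc m)) ≈BD eval (σB i) (h m))
    × (∀ m → eval (zeroAt (b 1)) (h (suc m)) ≈BD eval shiftBD (h m))

  -- a_j ↦ image in terms of b, d (for h_m):
  --   a_{2i+1} = (d_{i+1}+...+d_m) - (b_1+...+b_i),
  --   a_{2i}   = (d_i+...+d_m) - (b_1+...+b_i)
  σab : ℕ → ℕ → Poly BD
  σab m zero = 0P
  σab m (suc j) =
    if evenB (suc j)
    then sumP (λ t → var (d t)) (⌊ suc j /2⌋) m -P sumP (λ t → var (b t)) 1 (⌊ suc j /2⌋)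
    else sumP (λ t → var (d t)) (suc ⌊ suc j /2⌋) m -P sumP (λ t → var (b t)) 1 (⌊ suc j /2⌋)

  Φab : (ℕ → Poly ℕ) → ℕ → Poly BD
  Φab P m = eval (σab m) (P (suc (2 ℕ.* m)))

  τ : BD → Poly ℕ
  τ (inj₁ zero) = 0P
  τ (inj₁ (suc i)) = var (2 ℕ.* suc i ∸ 1) -P var (2 ℕ.* suc i)
  τ (inj₂ zero) = 0P
  τ (inj₂ (suc i)) = var (2 ℕ.* suc i) -P var (suc (2 ℕ.* suc i))

  -- P_{2m+1} = h_m(τ), P_{2m} = P_{2m+1}(a_1,..,a_{2m},0)
  Φba : (ℕ → Poly BD) → ℕ → Poly ℕ
  Φba h n = if evenB n
            then eval (killA (suc n)) (eval τ (h ⌊ n /2⌋))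
            else eval τ (h ⌊ n /2⌋)

module Submission where

-- The two maps are substitutions, i.e. algebra morphisms, so everything is reduced to statements about single letters.
-- Since (b_i, d_i) ↦ (a_{2i-1} - a_{2i}, a_{2i} - a_{2i+1}) is a left inverse of the affine change of variables defining Φ_{a→b,d},
-- Φ_{a→b,d} ∘ Φ_{b,d→a} is the identity letter by letter. The defining relations correspond to each other:
-- setting d_i = 0 (resp. b_i = 0) after Φ_{a→b,d} makes a_{2i} and a_{2i+1} (resp. a_{2i-1} and a_{2i}) equal, so
-- the Sol_NC relation merging these two letters applies, and after relabelling the remaining letters it becomes the
-- corresponding Sol_NC' relation. Conversely, merging a_{i+1} into a_i after Φ_{b,d→a} kills the letter b_k or d_k
-- whose image is a_i - a_{i+1}, so the Sol_NC' relations give the Sol_NC ones.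

open import Defs
open import Algebra.Bundles using (CommutativeRing)
open import Data.Nat using (ℕ)
open import Data.Product using (_×_; ∃)

open import Data.Nat.Base using (zero; suc; _+_; _*_; _∸_; _≤_; _<_; z≤n; s≤s; _<ᵇ_; _≡ᵇ_; ⌊_/2⌋)
import Data.Nat.Properties as ℕ
open import Data.Bool using (true; false; if_then_else_; T)
open import Data.Unit using (tt)
open import Data.Empty using (⊥-elim)
open import Data.List using (List; []; _∷_; _++_; map; foldr; applyUpTo; length; deduplicate)
import Data.List.Properties as List
open import Data.List.Relation.Unary.Any using (Any; here; there)
open import Data.List.Relation.Unary.All using (All; []; _∷_)
import Data.List.Relation.Unary.All as All
import Data.List.Relation.Unary.All.Properties as Allₚ
open import Data.List.Membership.Propositional using (_∈_; _∉_)
import Data.List.Membership.Propositional.Properties as Membership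
open import Data.List.Relation.Unary.Unique.Propositional using (Unique)
open import Data.List.Relation.Unary.AllPairs using ([]; _∷_)
open import Data.Sum using (_⊎_; inj₁; inj₂)
open import Data.Product using (_,_; proj₁; proj₂)
open import Relation.Nullary using (¬_; Dec; yes; no; does)
open import Relation.Nullary.Decidable using (_×-dec_)
open import Relation.Binary.Bundles using (Setoid)
open import Relation.Binary.Definitions using (DecidableEquality; tri<; tri≈; tri>)
import Relation.Binary.PropositionalEquality as ≡
open ≡ using (_≡_; _≢_; refl)
import Relation.Binary.Reasoning.Setoid as SetoidReasoning

true-if-T : ∀ {x} → T x → x ≡ true
true-if-T {true} _ = refl

false-if-¬T : ∀ {x} → ¬ T x → x ≡ false
false-if-¬T {false} _ = refl
false-if-¬T {true} n = ⊥-elim (n tt)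

<ᵇ-true : ∀ {k i} → k < i → (k <ᵇ i) ≡ true
<ᵇ-true lt = true-if-T (ℕ.<⇒<ᵇ lt)

<ᵇ-false : ∀ {k i} → ¬ k < i → (k <ᵇ i) ≡ false
<ᵇ-false {k} {i} nl = false-if-¬T (λ t → nl (ℕ.<ᵇ⇒< k i t))

≡ᵇ-true : ∀ {k i} → k ≡ i → (k ≡ᵇ i) ≡ true
≡ᵇ-true {k} {i} e = true-if-T (ℕ.≡⇒≡ᵇ k i e)

≡ᵇ-false : ∀ {k i} → k ≢ i → (k ≡ᵇ i) ≡ false
≡ᵇ-false {k} {i} ne = false-if-¬T (λ t → ne (ℕ.≡ᵇ⇒≡ k i t))

evenB-double : ∀ l → evenB (l + l) ≡ true
evenB-double zero = refl
evenB-double (suc l) rewrite ℕ.+-suc l l = evenB-double l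

evenB-odd : ∀ l → evenB (suc (l + l)) ≡ false
evenB-odd zero = refl
evenB-odd (suc l) rewrite ℕ.+-suc l l = evenB-odd l

⌊double/2⌋ : ∀ l → ⌊ l + l /2⌋ ≡ l
⌊double/2⌋ zero = refl
⌊double/2⌋ (suc l) rewrite ℕ.+-suc l l = ≡.cong suc (⌊double/2⌋ l)

⌊odd/2⌋ : ∀ l → ⌊ suc (l + l) /2⌋ ≡ l
⌊odd/2⌋ zero = refl
⌊odd/2⌋ (suc l) rewrite ℕ.+-suc l l = ≡.cong suc (⌊odd/2⌋ l)

2*n≡n+n : ∀ l → 2 * l ≡ l + l
2*n≡n+n l = ≡.cong (l +_) (ℕ.+-identityʳ l)

data Parity : ℕ → Set where
  even : ∀ l → Parity (l + l)
  odd  : ∀ l → Parity (suc (l + l))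

parity : ∀ k → Parity k
parity zero = even 0
parity (suc k) with parity k
... | even l = odd l
... | odd l = ≡.subst Parity (≡.cong suc (ℕ.+-suc l l)) (even (suc l))

double-injective : ∀ {a b} → a + a ≡ b + b → a ≡ b
double-injective {a} {b} e = ≡.trans (≡.sym (⌊double/2⌋ a)) (≡.trans (≡.cong ⌊_/2⌋ e) (⌊double/2⌋ b))

odd≢double : ∀ a b → suc (a + a) ≢ b + b
odd≢double a b e with ≡.trans (≡.sym (evenB-odd a)) (≡.trans (≡.cong evenB e) (evenB-double b))
... | ()

double-< : ∀ {a b} → a < b → a + a < b + b
double-< lt = ℕ.+-mono-< lt lt

double-≤ : ∀ {a b} → a ≤ b → a + a ≤ b + b
double-≤ le = ℕ.+-mono-≤ le le

double-<⁻ : ∀ {a b} → a + a < b + b → a < b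
double-<⁻ {a} {b} lt with a ℕ.<? b
... | yes p = p
... | no np = ⊥-elim (ℕ.<⇒≱ lt (double-≤ (ℕ.≮⇒≥ np)))

double-≤⁻ : ∀ {a b} → a + a ≤ b + b → a ≤ b
double-≤⁻ {a} {b} le with a ℕ.≤? b
... | yes p = p
... | no np = ⊥-elim (ℕ.≤⇒≯ le (double-< (ℕ.≰⇒> np)))

≢-< : ∀ {t i} → t < i → t ≢ i
≢-< = ℕ.<⇒≢

≢-> : ∀ {t i} → i < t → t ≢ i
≢-> lt e = ℕ.<⇒≢ lt (≡.sym e)

-- oddIx k = 2k+1 and evenIx k = 2k+2: τ sends b_{k+1} to a_{2k+1} - a_{2k+2} and d_{k+1} to a_{2k+2} - a_{2k+3}.
oddIx evenIx : ℕ → ℕ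
oddIx k = suc (k + k)
evenIx k = suc k + suc k

evenIx≡suc-oddIx : ∀ k → evenIx k ≡ suc (oddIx k)
evenIx≡suc-oddIx k = ≡.cong suc (ℕ.+-suc k k)

2+double : ∀ l → 2 + (l + l) ≡ evenIx l
2+double l = ≡.sym (evenIx≡suc-oddIx l)

2+oddIx : ∀ k → 2 + oddIx k ≡ oddIx (suc k)
2+oddIx k = ≡.cong (λ z → suc (suc z)) (≡.sym (ℕ.+-suc k k))

2+evenIx : ∀ k → 2 + evenIx k ≡ evenIx (suc k)
2+evenIx k = ≡.cong (λ z → suc (suc z)) (≡.sym (ℕ.+-suc k (suc k)))

oddIx-injective : ∀ {k j} → oddIx k ≡ oddIx j → k ≡ j
oddIx-injective e = double-injective (ℕ.suc-injective e)

evenIx-injective : ∀ {k j} → evenIx k ≡ evenIx j → k ≡ j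
evenIx-injective {k} {j} e = ℕ.suc-injective (double-injective e)

oddIx≢evenIx : ∀ {k j} → oddIx k ≢ evenIx j
oddIx≢evenIx {k} {j} e = odd≢double j k (≡.sym (ℕ.suc-injective (≡.trans e (evenIx≡suc-oddIx j))))

evenIx≢oddIx : ∀ {k j} → evenIx k ≢ oddIx j
evenIx≢oddIx {k} {j} e = oddIx≢evenIx {j} {k} (≡.sym e)

oddIx-< : ∀ {k j} → k < j → oddIx k < oddIx j
oddIx-< lt = s≤s (double-< lt)

oddIx-≮ : ∀ {k j} → j ≤ k → ¬ oddIx k < oddIx j
oddIx-≮ le q = ℕ.<⇒≱ (ℕ.≤-pred q) (double-≤ le)

evenIx-< : ∀ {k j} → k < j → evenIx k < evenIx j
evenIx-< lt = double-< (s≤s lt)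

evenIx-≮ : ∀ {k j} → j ≤ k → ¬ evenIx k < evenIx j
evenIx-≮ le q = ℕ.<⇒≱ q (double-≤ (s≤s le))

oddIx<evenIx : ∀ {k j} → k ≤ j → oddIx k < evenIx j
oddIx<evenIx {k} {j} le = ≡.subst (oddIx k <_) (≡.sym (evenIx≡suc-oddIx j)) (s≤s (s≤s (double-≤ le)))

oddIx≮evenIx : ∀ {k j} → j < k → ¬ oddIx k < evenIx j
oddIx≮evenIx {k} {j} lt q = ℕ.<⇒≱ q (≡.subst (_≤ oddIx k) (≡.sym (evenIx≡suc-oddIx j)) (s≤s (double-< lt)))

evenIx<oddIx : ∀ {k j} → k < j → evenIx k < oddIx j
evenIx<oddIx {k} {j} lt =
  ≡.subst (_< oddIx j) (≡.sym (evenIx≡suc-oddIx k)) (s≤s (≡.subst (_≤ j + j) (evenIx≡suc-oddIx k) (double-≤ lt)))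

evenIx≮oddIx : ∀ {k j} → j ≤ k → ¬ evenIx k < oddIx j
evenIx≮oddIx {k} {j} le q =
  ℕ.<⇒≱ (≡.subst (_< oddIx j) (evenIx≡suc-oddIx k) q) (ℕ.≤-trans (s≤s (double-≤ le)) (ℕ.n≤1+n _))

module Polynomials {c ℓ} (R : CommutativeRing c ℓ) where

  open WithRing R
  open CommutativeRing R using (Carrier; _≈_; 0#; 1#; -_; setoid; +-cong; +-assoc; +-comm; *-assoc; *-comm;
    +-identityˡ; +-identityʳ; *-identityˡ; *-identityʳ; zeroˡ; zeroʳ; distribˡ; distribʳ; +-congˡ; +-congʳ; *-congˡ; *-congʳ;
    -‿inverseʳ; -‿cong; +-commutativeSemigroup)
    renaming (_+_ to _+ᵣ_; _*_ to _*ᵣ_; refl to ≈-refl; sym to ≈-sym; trans to ≈-trans; reflexive to ≈-reflexive)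
  open import Algebra.Properties.Ring (CommutativeRing.ring R) using (-1*x≈-x; -‿involutive)
  open import Algebra.Properties.CommutativeSemigroup +-commutativeSemigroup using (interchange)

  -- Every coefficient identity is proved through the linear functional lin f p = Σ_{(u,a) ∈ p} a · f u:
  -- coeff p w is lin (δ w) p, and lin f respects ≋ because p can be expanded over its deduplicated support.
  module Linear {X : Set} (_≟_ : DecidableEquality X) where
    open SetoidReasoning setoid

    _≟w_ : DecidableEquality (List X)
    _≟w_ = List.≡-dec _≟_

    δ : List X → List X → Carrier
    δ w u = if does (u ≟w w) then 1# else 0#

    lin : (List X → Carrier) → Poly X → Carrier
    lin f p = foldr (λ t acc → (proj₂ t *ᵣ f (proj₁ t)) +ᵣ acc) 0# p

    coeff≈lin-δ : ∀ p w → coeff _≟_ p w ≈ lin (δ w) p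
    coeff≈lin-δ [] w = ≈-refl
    coeff≈lin-δ ((u , a) ∷ p) w with does (u ≟w w)
    ... | true = +-cong (≈-sym (*-identityʳ a)) (coeff≈lin-δ p w)
    ... | false = begin
          coeff _≟_ p w ≈⟨ coeff≈lin-δ p w ⟩
          lin (δ w) p ≈⟨ ≈-sym (+-identityˡ _) ⟩
          0# +ᵣ lin (δ w) p ≈⟨ +-congʳ (≈-sym (zeroʳ a)) ⟩
          a *ᵣ 0# +ᵣ lin (δ w) p ∎

    lin-++ : ∀ f p q → lin f (p ++ q) ≈ lin f p +ᵣ lin f q
    lin-++ f [] q = ≈-sym (+-identityˡ _)
    lin-++ f ((u , a) ∷ p) q = ≈-trans (+-congˡ (lin-++ f p q)) (≈-sym (+-assoc _ _ _))

    lin-· : ∀ f k p → lin f (k ·P p) ≈ k *ᵣ lin f p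
    lin-· f k [] = ≈-sym (zeroʳ k)
    lin-· f k ((u , a) ∷ p) = begin
      (k *ᵣ a) *ᵣ f u +ᵣ lin f (k ·P p) ≈⟨ +-cong (*-assoc _ _ _) (lin-· f k p) ⟩
      k *ᵣ (a *ᵣ f u) +ᵣ k *ᵣ lin f p ≈⟨ ≈-sym (distribˡ _ _ _) ⟩
      k *ᵣ (a *ᵣ f u +ᵣ lin f p) ∎

    lin-cong : ∀ {f g} p → (∀ u → f u ≈ g u) → lin f p ≈ lin g p
    lin-cong [] e = ≈-refl
    lin-cong ((u , a) ∷ p) e = +-cong (*-congˡ (e u)) (lin-cong p e)

    lin-+ᶠ : ∀ f g p → lin (λ u → f u +ᵣ g u) p ≈ lin f p +ᵣ lin g p
    lin-+ᶠ f g [] = ≈-sym (+-identityˡ _)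
    lin-+ᶠ f g ((u , a) ∷ p) = begin
      a *ᵣ (f u +ᵣ g u) +ᵣ lin (λ u → f u +ᵣ g u) p ≈⟨ +-cong (distribˡ _ _ _) (lin-+ᶠ f g p) ⟩
      (a *ᵣ f u +ᵣ a *ᵣ g u) +ᵣ (lin f p +ᵣ lin g p) ≈⟨ interchange _ _ _ _ ⟩
      (a *ᵣ f u +ᵣ lin f p) +ᵣ (a *ᵣ g u +ᵣ lin g p) ∎

    lin-*ᶠ : ∀ k f p → lin (λ u → k *ᵣ f u) p ≈ k *ᵣ lin f p
    lin-*ᶠ k f [] = ≈-sym (zeroʳ k)
    lin-*ᶠ k f ((u , a) ∷ p) = begin
      a *ᵣ (k *ᵣ f u) +ᵣ lin (λ u → k *ᵣ f u) p ≈⟨ +-cong commute (lin-*ᶠ k f p) ⟩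
      k *ᵣ (a *ᵣ f u) +ᵣ k *ᵣ lin f p ≈⟨ ≈-sym (distribˡ _ _ _) ⟩
      k *ᵣ (a *ᵣ f u +ᵣ lin f p) ∎
      where
      commute : a *ᵣ (k *ᵣ f u) ≈ k *ᵣ (a *ᵣ f u)
      commute = begin
        a *ᵣ (k *ᵣ f u) ≈⟨ ≈-sym (*-assoc _ _ _) ⟩
        (a *ᵣ k) *ᵣ f u ≈⟨ *-congʳ (*-comm _ _) ⟩
        (k *ᵣ a) *ᵣ f u ≈⟨ *-assoc _ _ _ ⟩
        k *ᵣ (a *ᵣ f u) ∎

    lin-0ᶠ : ∀ p → lin (λ _ → 0#) p ≈ 0#
    lin-0ᶠ [] = ≈-refl
    lin-0ᶠ ((u , a) ∷ p) = ≈-trans (+-cong (zeroʳ a) (lin-0ᶠ p)) (+-identityˡ _)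

    lin-map-prefix : ∀ f u a q → lin f (map (λ (v , a') → (u ++ v , a *ᵣ a')) q) ≈ a *ᵣ lin (λ v → f (u ++ v)) q
    lin-map-prefix f u a [] = ≈-sym (zeroʳ a)
    lin-map-prefix f u a ((v , a') ∷ q) = begin
      (a *ᵣ a') *ᵣ f (u ++ v) +ᵣ _ ≈⟨ +-cong (*-assoc _ _ _) (lin-map-prefix f u a q) ⟩
      a *ᵣ (a' *ᵣ f (u ++ v)) +ᵣ a *ᵣ lin (λ v → f (u ++ v)) q ≈⟨ ≈-sym (distribˡ _ _ _) ⟩
      a *ᵣ (a' *ᵣ f (u ++ v) +ᵣ lin (λ v → f (u ++ v)) q) ∎

    lin-*P : ∀ f p q → lin f (p *P q) ≈ lin (λ u → lin (λ v → f (u ++ v)) q) p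
    lin-*P f [] q = ≈-refl
    lin-*P f ((u , a) ∷ p) q = ≈-trans (lin-++ f (map _ q) (p *P q)) (+-cong (lin-map-prefix f u a q) (lin-*P f p q))

    sumOver : List (List X) → (List X → Carrier) → Carrier
    sumOver K g = foldr (λ k acc → g k +ᵣ acc) 0# K

    sumOver-cong : ∀ K {g h} → (∀ k → g k ≈ h k) → sumOver K g ≈ sumOver K h
    sumOver-cong [] e = ≈-refl
    sumOver-cong (k ∷ K) e = +-cong (e k) (sumOver-cong K e)

    sumOver-0 : ∀ K g → (∀ k → g k ≈ 0#) → sumOver K g ≈ 0#
    sumOver-0 [] g e = ≈-refl
    sumOver-0 (k ∷ K) g e = ≈-trans (+-cong (e k) (sumOver-0 K g e)) (+-identityˡ _)

    addAt : ∀ (u : List X) a (c f : List X → Carrier) k → Carrier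
    addAt u a c f k = (if does (u ≟w k) then a +ᵣ c k else c k) *ᵣ f k

    sumOver-addAt-∉ : ∀ K u a c f → u ∉ K → sumOver K (addAt u a c f) ≈ sumOver K (λ k → c k *ᵣ f k)
    sumOver-addAt-∉ [] u a c f n = ≈-refl
    sumOver-addAt-∉ (k ∷ K) u a c f n with u ≟w k
    ... | yes e = ⊥-elim (n (here e))
    ... | no _ = +-congˡ (sumOver-addAt-∉ K u a c f (λ m → n (there m)))

    sumOver-addAt-∈ : ∀ K u a c f → u ∈ K → Unique K →
                      sumOver K (addAt u a c f) ≈ a *ᵣ f u +ᵣ sumOver K (λ k → c k *ᵣ f k)
    sumOver-addAt-∈ (k ∷ K) u a c f mem (u∉K ∷ uK) with u ≟w k
    ... | yes refl = begin
          (a +ᵣ c u) *ᵣ f u +ᵣ sumOver K (addAt u a c f)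
            ≈⟨ +-cong (distribʳ _ _ _) (sumOver-addAt-∉ K u a c f (λ m → All.lookup u∉K m refl)) ⟩
          (a *ᵣ f u +ᵣ c u *ᵣ f u) +ᵣ sumOver K (λ k → c k *ᵣ f k) ≈⟨ +-assoc _ _ _ ⟩
          a *ᵣ f u +ᵣ (c u *ᵣ f u +ᵣ sumOver K (λ k → c k *ᵣ f k)) ∎
    ... | no ne with mem
    ...   | here e = ⊥-elim (ne e)
    ...   | there m = begin
          c k *ᵣ f k +ᵣ sumOver K (addAt u a c f) ≈⟨ +-congˡ (sumOver-addAt-∈ K u a c f m uK) ⟩
          c k *ᵣ f k +ᵣ (a *ᵣ f u +ᵣ sumOver K (λ k → c k *ᵣ f k)) ≈⟨ ≈-sym (+-assoc _ _ _) ⟩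
          (c k *ᵣ f k +ᵣ a *ᵣ f u) +ᵣ sumOver K (λ k → c k *ᵣ f k) ≈⟨ +-congʳ (+-comm _ _) ⟩
          (a *ᵣ f u +ᵣ c k *ᵣ f k) +ᵣ sumOver K (λ k → c k *ᵣ f k) ≈⟨ +-assoc _ _ _ ⟩
          a *ᵣ f u +ᵣ (c k *ᵣ f k +ᵣ sumOver K (λ k → c k *ᵣ f k)) ∎

    lin-expand : ∀ K → Unique K → ∀ f p → All (λ t → proj₁ t ∈ K) p →
                 lin f p ≈ sumOver K (λ k → coeff _≟_ p k *ᵣ f k)
    lin-expand K uK f [] al = ≈-sym (sumOver-0 K _ (λ k → zeroˡ (f k)))
    lin-expand K uK f ((u , a) ∷ p) (m ∷ al) = begin
      a *ᵣ f u +ᵣ lin f p ≈⟨ +-congˡ (lin-expand K uK f p al) ⟩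
      a *ᵣ f u +ᵣ sumOver K (λ k → coeff _≟_ p k *ᵣ f k) ≈⟨ ≈-sym (sumOver-addAt-∈ K u a (coeff _≟_ p) f m uK) ⟩
      sumOver K (addAt u a (coeff _≟_ p) f) ∎

    support : Poly X → List (List X)
    support p = map proj₁ p

    All-∈-support : ∀ p (K : List (List X)) → (∀ {u} → u ∈ support p → u ∈ K) → All (λ t → proj₁ t ∈ K) p
    All-∈-support [] K f = []
    All-∈-support ((u , a) ∷ p) K f = f (here refl) ∷ All-∈-support p K (λ m → f (there m))

    open import Data.List.Relation.Unary.Unique.DecPropositional.Properties _≟w_ using (deduplicate-!)

    lin-resp : ∀ f p q → Eq _≟_ p q → lin f p ≈ lin f q
    lin-resp f p q e = begin
      lin f p ≈⟨ lin-expand K uK f p (All-∈-support p K (λ m → Membership.∈-deduplicate⁺ _≟w_ (Membership.∈-++⁺ˡ m))) ⟩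
      sumOver K (λ k → coeff _≟_ p k *ᵣ f k) ≈⟨ sumOver-cong K (λ k → *-congʳ (e k)) ⟩
      sumOver K (λ k → coeff _≟_ q k *ᵣ f k)
        ≈⟨ ≈-sym (lin-expand K uK f q (All-∈-support q K (λ m → Membership.∈-deduplicate⁺ _≟w_ (Membership.∈-++⁺ʳ (support p) m)))) ⟩
      lin f q ∎
      where
      K = deduplicate _≟w_ (support p ++ support q)
      uK = deduplicate-! (support p ++ support q)

    lin-cong-off-support : ∀ f g p → (∀ u → (coeff _≟_ p u ≈ 0#) ⊎ (f u ≈ g u)) → lin f p ≈ lin g p
    lin-cong-off-support f g p h = begin
      lin f p ≈⟨ lin-expand K uK f p all∈K ⟩
      sumOver K (λ k → coeff _≟_ p k *ᵣ f k) ≈⟨ sumOver-cong K termwise ⟩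
      sumOver K (λ k → coeff _≟_ p k *ᵣ g k) ≈⟨ ≈-sym (lin-expand K uK g p all∈K) ⟩
      lin g p ∎
      where
      K = deduplicate _≟w_ (support p)
      uK = deduplicate-! (support p)
      all∈K = All-∈-support p K (λ m → Membership.∈-deduplicate⁺ _≟w_ m)
      termwise : ∀ k → coeff _≟_ p k *ᵣ f k ≈ coeff _≟_ p k *ᵣ g k
      termwise k with h k
      ... | inj₁ z = ≈-trans (*-congʳ z) (≈-trans (zeroˡ _) (≈-sym (≈-trans (*-congʳ z) (zeroˡ _))))
      ... | inj₂ e = *-congˡ e

    lin-vanishes : ∀ f p → (∀ u → (coeff _≟_ p u ≈ 0#) ⊎ (f u ≈ 0#)) → lin f p ≈ 0#
    lin-vanishes f p h = ≈-trans (lin-cong-off-support f (λ _ → 0#) p h) (lin-0ᶠ p)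

    infix 4 _≋_
    record _≋_ (p q : Poly X) : Set ℓ where
      constructor ⟪_⟫
      field ap : ∀ w → coeff _≟_ p w ≈ coeff _≟_ q w
    open _≋_ public

    ≋-refl : ∀ {p} → p ≋ p
    ≋-refl = ⟪ (λ w → ≈-refl) ⟫

    ≋-sym : ∀ {p q} → p ≋ q → q ≋ p
    ≋-sym e = ⟪ (λ w → ≈-sym (ap e w)) ⟫

    ≋-trans : ∀ {p q r} → p ≋ q → q ≋ r → p ≋ r
    ≋-trans e f = ⟪ (λ w → ≈-trans (ap e w) (ap f w)) ⟫

    ≋-reflexive : ∀ {p q} → p ≡ q → p ≋ q
    ≋-reflexive refl = ≋-refl

    ≋-setoid : Setoid c ℓ
    ≋-setoid = record { Carrier = Poly X ; _≈_ = _≋_ ;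
      isEquivalence = record { refl = ≋-refl ; sym = ≋-sym ; trans = ≋-trans } }

    coeff-++ : ∀ p q w → coeff _≟_ (p ++ q) w ≈ coeff _≟_ p w +ᵣ coeff _≟_ q w
    coeff-++ p q w = ≈-trans (coeff≈lin-δ (p ++ q) w)
      (≈-trans (lin-++ (δ w) p q) (+-cong (≈-sym (coeff≈lin-δ p w)) (≈-sym (coeff≈lin-δ q w))))

    coeff-· : ∀ k p w → coeff _≟_ (k ·P p) w ≈ k *ᵣ coeff _≟_ p w
    coeff-· k p w = ≈-trans (coeff≈lin-δ (k ·P p) w) (≈-trans (lin-· (δ w) k p) (*-congˡ (≈-sym (coeff≈lin-δ p w))))

    coeff-*P : ∀ p q w → coeff _≟_ (p *P q) w ≈ lin (λ u → lin (λ v → δ w (u ++ v)) q) p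
    coeff-*P p q w = ≈-trans (coeff≈lin-δ (p *P q) w) (lin-*P (δ w) p q)

    δ-≢ : ∀ w u → u ≢ w → δ w u ≈ 0#
    δ-≢ w u ne with u ≟w w
    ... | yes e = ⊥-elim (ne e)
    ... | no _ = ≈-refl

    ++-cong : ∀ {p p' q q'} → p ≋ p' → q ≋ q' → (p ++ q) ≋ (p' ++ q')
    ++-cong {p} {p'} {q} {q'} e f =
      ⟪ (λ w → ≈-trans (coeff-++ p q w) (≈-trans (+-cong (ap e w) (ap f w)) (≈-sym (coeff-++ p' q' w)))) ⟫

    ·P-cong : ∀ k {p p'} → p ≋ p' → (k ·P p) ≋ (k ·P p')
    ·P-cong k {p} {p'} e = ⟪ (λ w → ≈-trans (coeff-· k p w) (≈-trans (*-congˡ (ap e w)) (≈-sym (coeff-· k p' w)))) ⟫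

    ·P-identity : ∀ p → (1# ·P p) ≋ p
    ·P-identity p = ⟪ (λ w → ≈-trans (coeff-· 1# p w) (*-identityˡ _)) ⟫

    ++-identityʳ : ∀ p → (p ++ []) ≋ p
    ++-identityʳ p = ≋-reflexive (List.++-identityʳ p)

    *P-cong : ∀ {p p' q q'} → p ≋ p' → q ≋ q' → (p *P q) ≋ (p' *P q')
    *P-cong {p} {p'} {q} {q'} e f = ⟪ (λ w → begin
      coeff _≟_ (p *P q) w ≈⟨ coeff-*P p q w ⟩
      lin (λ u → lin (λ v → δ w (u ++ v)) q) p ≈⟨ lin-cong p (λ u → lin-resp _ q q' (ap f)) ⟩
      lin (λ u → lin (λ v → δ w (u ++ v)) q') p ≈⟨ lin-resp _ p p' (ap e) ⟩
      lin (λ u → lin (λ v → δ w (u ++ v)) q') p' ≈⟨ ≈-sym (coeff-*P p' q' w) ⟩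
      coeff _≟_ (p' *P q') w ∎) ⟫

    *P-assoc : ∀ p q r → ((p *P q) *P r) ≋ (p *P (q *P r))
    *P-assoc p q r = ⟪ (λ w → begin
      coeff _≟_ ((p *P q) *P r) w ≈⟨ coeff-*P (p *P q) r w ⟩
      lin (λ t → lin (λ x → δ w (t ++ x)) r) (p *P q) ≈⟨ lin-*P _ p q ⟩
      lin (λ u → lin (λ v → lin (λ x → δ w ((u ++ v) ++ x)) r) q) p
        ≈⟨ lin-cong p (λ u → lin-cong q (λ v → lin-cong r (λ x → ≈-reflexive (≡.cong (δ w) (List.++-assoc u v x))))) ⟩
      lin (λ u → lin (λ v → lin (λ x → δ w (u ++ (v ++ x))) r) q) p ≈⟨ lin-cong p (λ u → ≈-sym (lin-*P _ q r)) ⟩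
      lin (λ u → lin (λ y → δ w (u ++ y)) (q *P r)) p ≈⟨ ≈-sym (coeff-*P p (q *P r) w) ⟩
      coeff _≟_ (p *P (q *P r)) w ∎) ⟫

    *P-identityˡ : ∀ p → (1P *P p) ≋ p
    *P-identityˡ p = ⟪ (λ w → begin
      coeff _≟_ (1P *P p) w ≈⟨ coeff-*P 1P p w ⟩
      1# *ᵣ lin (δ w) p +ᵣ 0# ≈⟨ ≈-trans (+-identityʳ _) (*-identityˡ _) ⟩
      lin (δ w) p ≈⟨ ≈-sym (coeff≈lin-δ p w) ⟩
      coeff _≟_ p w ∎) ⟫

    *P-identityʳ : ∀ p → (p *P 1P) ≋ p
    *P-identityʳ p = ⟪ (λ w → begin
      coeff _≟_ (p *P 1P) w ≈⟨ coeff-*P p 1P w ⟩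
      lin (λ u → 1# *ᵣ δ w (u ++ []) +ᵣ 0#) p
        ≈⟨ lin-cong p (λ u → ≈-trans (+-identityʳ _) (≈-trans (*-identityˡ _) (≈-reflexive (≡.cong (δ w) (List.++-identityʳ u))))) ⟩
      lin (δ w) p ≈⟨ ≈-sym (coeff≈lin-δ p w) ⟩
      coeff _≟_ p w ∎) ⟫

    monomial-cong : ∀ (u : List X) {a b} → a ≈ b → ((u , a) ∷ []) ≋ ((u , b) ∷ [])
    monomial-cong u e = ⟪ coeffs ⟫
      where
      coeffs : ∀ w → coeff _≟_ ((u , _) ∷ []) w ≈ coeff _≟_ ((u , _) ∷ []) w
      coeffs w with does (u ≟w w)
      ... | true = +-congʳ e
      ... | false = ≈-refl

    coeff-monomial-≢ : ∀ w u a → u ≢ w → coeff _≟_ ((u , a) ∷ []) w ≈ 0#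
    coeff-monomial-≢ w u a ne with u ≟w w
    ... | yes e = ⊥-elim (ne e)
    ... | no _ = ≈-refl

    module Support (ok : X → Set) (ok? : ∀ x → Dec (ok x)) where

      Bad : List X → Set
      Bad = Any (λ x → ¬ ok x)

      all-ok⊎bad : ∀ u → All ok u ⊎ Bad u
      all-ok⊎bad [] = inj₁ []
      all-ok⊎bad (x ∷ u) with ok? x | all-ok⊎bad u
      ... | yes o | inj₁ a = inj₁ (o ∷ a)
      ... | yes o | inj₂ b = inj₂ (there b)
      ... | no n | _ = inj₂ (here n)

      ¬all-ok∧bad : ∀ {w} → All ok w → ¬ Bad w
      ¬all-ok∧bad (o ∷ a) (here n) = n o
      ¬all-ok∧bad (o ∷ a) (there b) = ¬all-ok∧bad a b

      Uses : Poly X → Set ℓ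
      Uses = UsesOnly _≟_ ok

      uses-[] : Uses []
      uses-[] w b = ≈-refl

      uses-++ : ∀ p q → Uses p → Uses q → Uses (p ++ q)
      uses-++ p q up uq w b = ≈-trans (coeff-++ p q w) (≈-trans (+-cong (up w b) (uq w b)) (+-identityˡ _))

      uses-· : ∀ k p → Uses p → Uses (k ·P p)
      uses-· k p up w b = ≈-trans (coeff-· k p w) (≈-trans (*-congˡ (up w b)) (zeroʳ k))

      uses--P : ∀ p q → Uses p → Uses q → Uses (p -P q)
      uses--P p q up uq = uses-++ p (-P q) up (uses-· (- 1#) q uq)

      uses-var : ∀ x → ok x → Uses (var x)
      uses-var x o w b = coeff-monomial-≢ w (x ∷ []) 1# (λ e → ¬all-ok∧bad (≡.subst (All ok) e (o ∷ [])) b)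

      uses-1P : Uses 1P
      uses-1P [] ()
      uses-1P (y ∷ w) b = ≈-refl

      uses-*P : ∀ p q → Uses p → Uses q → Uses (p *P q)
      uses-*P p q up uq w b = ≈-trans (coeff-*P p q w) (lin-vanishes _ p outer)
        where
        outer : ∀ u → (coeff _≟_ p u ≈ 0#) ⊎ (lin (λ v → δ w (u ++ v)) q ≈ 0#)
        outer u with all-ok⊎bad u
        ... | inj₂ bu = inj₁ (up u bu)
        ... | inj₁ au = inj₂ (lin-vanishes _ q inner)
          where
          inner : ∀ v → (coeff _≟_ q v ≈ 0#) ⊎ (δ w (u ++ v) ≈ 0#)
          inner v with all-ok⊎bad v
          ... | inj₂ bv = inj₁ (uq v bv)
          ... | inj₁ av = inj₂ (δ-≢ w (u ++ v) (λ e → ¬all-ok∧bad (≡.subst (All ok) e (Allₚ.++⁺ au av)) b))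

    module Degree where

      deg-[] : ∀ n → DegLe _≟_ n []
      deg-[] n w l = ≈-refl

      deg-++ : ∀ n p q → DegLe _≟_ n p → DegLe _≟_ n q → DegLe _≟_ n (p ++ q)
      deg-++ n p q dp dq w l = ≈-trans (coeff-++ p q w) (≈-trans (+-cong (dp w l) (dq w l)) (+-identityˡ _))

      deg-· : ∀ n k p → DegLe _≟_ n p → DegLe _≟_ n (k ·P p)
      deg-· n k p dp w l = ≈-trans (coeff-· k p w) (≈-trans (*-congˡ (dp w l)) (zeroʳ k))

      deg--P : ∀ n p q → DegLe _≟_ n p → DegLe _≟_ n q → DegLe _≟_ n (p -P q)
      deg--P n p q dp dq = deg-++ n p (-P q) dp (deg-· n (- 1#) q dq)

      deg-var : ∀ x → DegLe _≟_ 1 (var x)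
      deg-var x w l = coeff-monomial-≢ w (x ∷ []) 1# (λ e → ℕ.<-irrefl (≡.cong length e) l)

      deg-1P : DegLe _≟_ 0 1P
      deg-1P [] ()
      deg-1P (y ∷ w) l = ≈-refl

      deg-*P : ∀ m n p q → DegLe _≟_ m p → DegLe _≟_ n q → DegLe _≟_ (m + n) (p *P q)
      deg-*P m n p q dp dq w l = ≈-trans (coeff-*P p q w) (lin-vanishes _ p outer)
        where
        outer : ∀ u → (coeff _≟_ p u ≈ 0#) ⊎ (lin (λ v → δ w (u ++ v)) q ≈ 0#)
        outer u with length u ℕ.≤? m
        ... | no nu = inj₁ (dp u (ℕ.≰⇒> nu))
        ... | yes lu = inj₂ (lin-vanishes _ q inner)
          where
          inner : ∀ v → (coeff _≟_ q v ≈ 0#) ⊎ (δ w (u ++ v) ≈ 0#)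
          inner v with length v ℕ.≤? n
          ... | no nv = inj₁ (dq v (ℕ.≰⇒> nv))
          ... | yes lv = inj₂ (δ-≢ w (u ++ v) (λ e → ℕ.<⇒≱ l (≡.subst (λ z → length z ≤ m + n) e
                 (≡.subst (_≤ m + n) (≡.sym (List.length-++ u)) (ℕ.+-mono-≤ lu lv)))))

  module Substitution {X Y : Set} (_≟X_ : DecidableEquality X) (_≟Y_ : DecidableEquality Y) where
    private
      module LX = Linear _≟X_
      module LY = Linear _≟Y_
    open LY using (_≋_; ⟪_⟫; ap; ≋-refl; ≋-sym; ≋-trans)
    open SetoidReasoning setoid

    lin-eval : ∀ (σ : X → Poly Y) g p → LY.lin g (eval σ p) ≈ LX.lin (λ u → LY.lin g (evalMono σ u)) p
    lin-eval σ g [] = ≈-refl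
    lin-eval σ g ((u , a) ∷ p) = begin
      LY.lin g ((a ·P evalMono σ u) ++ eval σ p) ≈⟨ LY.lin-++ g (a ·P evalMono σ u) (eval σ p) ⟩
      LY.lin g (a ·P evalMono σ u) +ᵣ LY.lin g (eval σ p) ≈⟨ +-cong (LY.lin-· g a (evalMono σ u)) (lin-eval σ g p) ⟩
      a *ᵣ LY.lin g (evalMono σ u) +ᵣ LX.lin (λ u → LY.lin g (evalMono σ u)) p ∎

    coeff-eval : ∀ (σ : X → Poly Y) p w → coeff _≟Y_ (eval σ p) w ≈ LX.lin (λ u → coeff _≟Y_ (evalMono σ u) w) p
    coeff-eval σ p w = ≈-trans (LY.coeff≈lin-δ (eval σ p) w)
      (≈-trans (lin-eval σ (LY.δ w) p) (LX.lin-cong p (λ u → ≈-sym (LY.coeff≈lin-δ (evalMono σ u) w))))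

    eval-cong : ∀ (σ : X → Poly Y) {p p'} → LX._≋_ p p' → eval σ p ≋ eval σ p'
    eval-cong σ {p} {p'} e =
      ⟪ (λ w → ≈-trans (coeff-eval σ p w) (≈-trans (LX.lin-resp _ p p' (LX.ap e)) (≈-sym (coeff-eval σ p' w)))) ⟫

    eval-++ : ∀ (σ : X → Poly Y) p q → eval σ (p ++ q) ≡ eval σ p ++ eval σ q
    eval-++ σ [] q = refl
    eval-++ σ ((u , a) ∷ p) q = ≡.trans (≡.cong ((a ·P evalMono σ u) ++_) (eval-++ σ p q))
      (≡.sym (List.++-assoc (a ·P evalMono σ u) (eval σ p) (eval σ q)))

    eval-· : ∀ (σ : X → Poly Y) k p → eval σ (k ·P p) ≋ (k ·P eval σ p)
    eval-· σ k p = ⟪ (λ w → begin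
      coeff _≟Y_ (eval σ (k ·P p)) w ≈⟨ coeff-eval σ (k ·P p) w ⟩
      LX.lin (λ u → coeff _≟Y_ (evalMono σ u) w) (k ·P p) ≈⟨ LX.lin-· _ k p ⟩
      k *ᵣ LX.lin (λ u → coeff _≟Y_ (evalMono σ u) w) p ≈⟨ *-congˡ (≈-sym (coeff-eval σ p w)) ⟩
      k *ᵣ coeff _≟Y_ (eval σ p) w ≈⟨ ≈-sym (LY.coeff-· k (eval σ p) w) ⟩
      coeff _≟Y_ (k ·P eval σ p) w ∎) ⟫

    eval-1P : ∀ (σ : X → Poly Y) → eval σ 1P ≋ 1P
    eval-1P σ = ≋-trans (LY.++-identityʳ (1# ·P 1P)) (LY.·P-identity 1P)

    eval-var : ∀ (σ : X → Poly Y) x → eval σ (var x) ≋ σ x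
    eval-var σ x = ≋-trans (LY.++-identityʳ (1# ·P (σ x *P 1P))) (≋-trans (LY.·P-identity (σ x *P 1P)) (LY.*P-identityʳ (σ x)))

    lin-swap : ∀ (H : List Y → List X → Carrier) (r : Poly Y) (q : Poly X) →
               LY.lin (λ s → LX.lin (λ v → H s v) q) r ≈ LX.lin (λ v → LY.lin (λ s → H s v) r) q
    lin-swap H [] q = ≈-sym (LX.lin-0ᶠ q)
    lin-swap H ((s , a) ∷ r) q = begin
      a *ᵣ LX.lin (λ v → H s v) q +ᵣ LY.lin (λ s → LX.lin (λ v → H s v) q) r
        ≈⟨ +-cong (≈-sym (LX.lin-*ᶠ a (H s) q)) (lin-swap H r q) ⟩
      LX.lin (λ v → a *ᵣ H s v) q +ᵣ LX.lin (λ v → LY.lin (λ s → H s v) r) q ≈⟨ ≈-sym (LX.lin-+ᶠ _ _ q) ⟩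
      LX.lin (λ v → a *ᵣ H s v +ᵣ LY.lin (λ s → H s v) r) q ∎

    evalMono-++ : ∀ (σ : X → Poly Y) u v → evalMono σ (u ++ v) ≋ (evalMono σ u *P evalMono σ v)
    evalMono-++ σ [] v = ≋-sym (LY.*P-identityˡ (evalMono σ v))
    evalMono-++ σ (x ∷ u) v = ≋-trans (LY.*P-cong (≋-refl {σ x}) (evalMono-++ σ u v))
      (≋-sym (LY.*P-assoc (σ x) (evalMono σ u) (evalMono σ v)))

    eval-*P : ∀ (σ : X → Poly Y) p q → eval σ (p *P q) ≋ (eval σ p *P eval σ q)
    eval-*P σ p q = ⟪ (λ w → begin
      coeff _≟Y_ (eval σ (p *P q)) w ≈⟨ coeff-eval σ (p *P q) w ⟩
      LX.lin (λ t → coeff _≟Y_ (M t) w) (p *P q) ≈⟨ LX.lin-*P _ p q ⟩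
      LX.lin (λ u → LX.lin (λ v → coeff _≟Y_ (M (u ++ v)) w) q) p
         ≈⟨ LX.lin-cong p (λ u → LX.lin-cong q (λ v → ≈-trans (ap (evalMono-++ σ u v) w) (LY.coeff-*P (M u) (M v) w))) ⟩
      LX.lin (λ u → LX.lin (λ v → LY.lin (λ s → LY.lin (λ y → LY.δ w (s ++ y)) (M v)) (M u)) q) p
         ≈⟨ LX.lin-cong p (λ u → ≈-sym (lin-swap (λ s v → LY.lin (λ y → LY.δ w (s ++ y)) (M v)) (M u) q)) ⟩
      LX.lin (λ u → LY.lin (λ s → LX.lin (λ v → LY.lin (λ y → LY.δ w (s ++ y)) (M v)) q) (M u)) p
         ≈⟨ LX.lin-cong p (λ u → LY.lin-cong (M u) (λ s → ≈-sym (lin-eval σ _ q))) ⟩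
      LX.lin (λ u → LY.lin (λ s → LY.lin (λ y → LY.δ w (s ++ y)) (eval σ q)) (M u)) p ≈⟨ ≈-sym (lin-eval σ _ p) ⟩
      LY.lin (λ s → LY.lin (λ y → LY.δ w (s ++ y)) (eval σ q)) (eval σ p) ≈⟨ ≈-sym (LY.coeff-*P (eval σ p) (eval σ q) w) ⟩
      coeff _≟Y_ (eval σ p *P eval σ q) w ∎) ⟫
      where M = evalMono σ

    eval-congˢ : ∀ {σ σ' : X → Poly Y} p → (∀ x → σ x ≋ σ' x) → eval σ p ≋ eval σ' p
    eval-congˢ {σ} {σ'} p e =
      ⟪ (λ w → ≈-trans (coeff-eval σ p w) (≈-trans (LX.lin-cong p (λ u → ap (evalMono-cong u) w)) (≈-sym (coeff-eval σ' p w)))) ⟫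
      where
      evalMono-cong : ∀ u → evalMono σ u ≋ evalMono σ' u
      evalMono-cong [] = ≋-refl
      evalMono-cong (x ∷ u) = LY.*P-cong (e x) (evalMono-cong u)

    module OnSupport (ok : X → Set) (ok? : ∀ x → Dec (ok x)) where
      open LX.Support ok ok? using (all-ok⊎bad)

      eval-congˢ-on : ∀ {σ σ' : X → Poly Y} p → UsesOnly _≟X_ ok p → (∀ x → ok x → σ x ≋ σ' x) → eval σ p ≋ eval σ' p
      eval-congˢ-on {σ} {σ'} p up e =
        ⟪ (λ w → ≈-trans (coeff-eval σ p w) (≈-trans (LX.lin-cong-off-support _ _ p (termwise w)) (≈-sym (coeff-eval σ' p w)))) ⟫
        where
        evalMono-cong : ∀ {u} → All ok u → evalMono σ u ≋ evalMono σ' u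
        evalMono-cong [] = ≋-refl
        evalMono-cong {x ∷ u} (o ∷ a) = LY.*P-cong (e x o) (evalMono-cong a)
        termwise : ∀ w u → (coeff _≟X_ p u ≈ 0#) ⊎ (coeff _≟Y_ (evalMono σ u) w ≈ coeff _≟Y_ (evalMono σ' u) w)
        termwise w u with all-ok⊎bad u
        ... | inj₁ a = inj₂ (ap (evalMono-cong a) w)
        ... | inj₂ b = inj₁ (up u b)

      uses-eval : (okY : Y → Set) (okY? : ∀ y → Dec (okY y)) → ∀ {σ : X → Poly Y} p → UsesOnly _≟X_ ok p →
                  (∀ x → ok x → UsesOnly _≟Y_ okY (σ x)) → UsesOnly _≟Y_ okY (eval σ p)
      uses-eval okY okY? {σ} p up h w b = ≈-trans (coeff-eval σ p w) (LX.lin-vanishes _ p termwise)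
        where
        open LY.Support okY okY? using (uses-1P; uses-*P)
        uses-evalMono : ∀ {u} → All ok u → UsesOnly _≟Y_ okY (evalMono σ u)
        uses-evalMono [] = uses-1P
        uses-evalMono {x ∷ u} (o ∷ a) = uses-*P (σ x) (evalMono σ u) (h x o) (uses-evalMono a)
        termwise : ∀ u → (coeff _≟X_ p u ≈ 0#) ⊎ (coeff _≟Y_ (evalMono σ u) w ≈ 0#)
        termwise u with all-ok⊎bad u
        ... | inj₁ a = inj₂ (uses-evalMono a w b)
        ... | inj₂ bu = inj₁ (up u bu)

    deg-eval : ∀ {σ : X → Poly Y} n p → DegLe _≟X_ n p → (∀ x → DegLe _≟Y_ 1 (σ x)) → DegLe _≟Y_ n (eval σ p)
    deg-eval {σ} n p dp h w l = ≈-trans (coeff-eval σ p w) (LX.lin-vanishes _ p termwise)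
      where
      open LY.Degree using (deg-1P; deg-*P)
      deg-evalMono : ∀ u → DegLe _≟Y_ (length u) (evalMono σ u)
      deg-evalMono [] = deg-1P
      deg-evalMono (x ∷ u) = deg-*P 1 (length u) (σ x) (evalMono σ u) (h x) (deg-evalMono u)
      termwise : ∀ u → (coeff _≟X_ p u ≈ 0#) ⊎ (coeff _≟Y_ (evalMono σ u) w ≈ 0#)
      termwise u with length u ℕ.≤? n
      ... | no nu = inj₁ (dp u (ℕ.≰⇒> nu))
      ... | yes lu = inj₂ (deg-evalMono u w (ℕ.≤-<-trans lu l))

  eval-var-id : ∀ {X} (_≟_ : DecidableEquality X) p → Linear._≋_ _≟_ (eval var p) p
  eval-var-id _≟_ p = ⟪ (λ w → begin
    coeff _≟_ (eval var p) w ≈⟨ coeff-eval var p w ⟩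
    lin (λ u → coeff _≟_ (evalMono var u) w) p
      ≈⟨ lin-cong p (λ u → ≈-trans (ap (evalMono-var u) w) (≈-trans (coeff≈lin-δ ((u , 1#) ∷ []) w) (≈-trans (+-identityʳ _) (*-identityˡ _)))) ⟩
    lin (δ w) p ≈⟨ ≈-sym (coeff≈lin-δ p w) ⟩
    coeff _≟_ p w ∎) ⟫
    where
    open Linear _≟_
    open SetoidReasoning setoid
    open Substitution _≟_ _≟_ using (coeff-eval)
    evalMono-var : ∀ u → evalMono var u ≋ ((u , 1#) ∷ [])
    evalMono-var [] = ≋-refl
    evalMono-var (x ∷ u) = ≋-trans (*P-cong (≋-refl {var x}) (evalMono-var u))
      (≋-trans (++-identityʳ ((x ∷ u , 1# *ᵣ 1#) ∷ [])) (monomial-cong (x ∷ u) (*-identityˡ 1#)))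

  module Composition {X Y Z : Set} (_≟X_ : DecidableEquality X) (_≟Y_ : DecidableEquality Y) (_≟Z_ : DecidableEquality Z) where
    private
      module LX = Linear _≟X_
      module LZ = Linear _≟Z_
      module SXY = Substitution _≟X_ _≟Y_
      module SYZ = Substitution _≟Y_ _≟Z_
      module SXZ = Substitution _≟X_ _≟Z_
    open SetoidReasoning setoid

    eval-∘ : ∀ (σ₁ : Y → Poly Z) (σ₂ : X → Poly Y) p → LZ._≋_ (eval σ₁ (eval σ₂ p)) (eval (λ x → eval σ₁ (σ₂ x)) p)
    eval-∘ σ₁ σ₂ p = LZ.⟪ (λ w → begin
      coeff _≟Z_ (eval σ₁ (eval σ₂ p)) w ≈⟨ LZ.coeff≈lin-δ (eval σ₁ (eval σ₂ p)) w ⟩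
      LZ.lin (LZ.δ w) (eval σ₁ (eval σ₂ p)) ≈⟨ SYZ.lin-eval σ₁ (LZ.δ w) (eval σ₂ p) ⟩
      Linear.lin _≟Y_ (λ t → LZ.lin (LZ.δ w) (evalMono σ₁ t)) (eval σ₂ p) ≈⟨ SXY.lin-eval σ₂ _ p ⟩
      LX.lin (λ u → Linear.lin _≟Y_ (λ t → LZ.lin (LZ.δ w) (evalMono σ₁ t)) (evalMono σ₂ u)) p
        ≈⟨ LX.lin-cong p (λ u → ≈-trans (≈-sym (SYZ.lin-eval σ₁ (LZ.δ w) (evalMono σ₂ u)))
             (≈-trans (≈-sym (LZ.coeff≈lin-δ (eval σ₁ (evalMono σ₂ u)) w)) (LZ.ap (evalMono-∘ u) w))) ⟩
      LX.lin (λ u → coeff _≟Z_ (evalMono (λ x → eval σ₁ (σ₂ x)) u) w) p ≈⟨ ≈-sym (SXZ.coeff-eval (λ x → eval σ₁ (σ₂ x)) p w) ⟩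
      coeff _≟Z_ (eval (λ x → eval σ₁ (σ₂ x)) p) w ∎) ⟫
      where
      evalMono-∘ : ∀ u → LZ._≋_ (eval σ₁ (evalMono σ₂ u)) (evalMono (λ x → eval σ₁ (σ₂ x)) u)
      evalMono-∘ [] = SYZ.eval-1P σ₁
      evalMono-∘ (x ∷ u) = LZ.≋-trans (SYZ.eval-*P σ₁ (σ₂ x) (evalMono σ₂ u)) (LZ.*P-cong (LZ.≋-refl {eval σ₁ (σ₂ x)}) (evalMono-∘ u))

  sumFrom : {X : Set} → (ℕ → Poly X) → ℕ → ℕ → Poly X
  sumFrom f k zero = []
  sumFrom f k (suc n) = f k ++ sumFrom f (suc k) n

  sumP≡sumFrom : ∀ {X} (f : ℕ → Poly X) k m → sumP f k m ≡ sumFrom f k (suc m ∸ k)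
  sumP≡sumFrom f k m = foldr-applyUpTo (k +_) k (suc m ∸ k) (λ i → refl)
    where
    foldr-applyUpTo : ∀ g k n → (∀ i → g i ≡ k + i) →
                      foldr (λ t acc → f t +P acc) 0P (applyUpTo g n) ≡ sumFrom f k n
    foldr-applyUpTo g k zero e = refl
    foldr-applyUpTo g k (suc n) e = ≡.cong₂ _++_ (≡.cong f (≡.trans (e 0) (ℕ.+-identityʳ k)))
      (foldr-applyUpTo (λ i → g (suc i)) (suc k) n (λ i → ≡.trans (e (suc i)) (ℕ.+-suc k i)))

  sumFrom-+ : ∀ {X} (f : ℕ → Poly X) k n₁ n₂ → sumFrom f k (n₁ + n₂) ≡ sumFrom f k n₁ ++ sumFrom f (k + n₁) n₂
  sumFrom-+ f k zero n₂ = ≡.cong (λ z → sumFrom f z n₂) (≡.sym (ℕ.+-identityʳ k))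
  sumFrom-+ f k (suc n₁) n₂ = ≡.trans (≡.cong (f k ++_) (≡.trans (sumFrom-+ f (suc k) n₁ n₂)
      (≡.cong (λ z → sumFrom f (suc k) n₁ ++ sumFrom f z n₂) (≡.sym (ℕ.+-suc k n₁)))))
    (≡.sym (List.++-assoc (f k) (sumFrom f (suc k) n₁) (sumFrom f (k + suc n₁) n₂)))

  sumP-shift : ∀ {X} (f : ℕ → Poly X) k m → sumP (λ t → f (suc t)) k m ≡ sumP f (suc k) (suc m)
  sumP-shift f k m = ≡.trans (sumP≡sumFrom _ k m) (≡.trans (sumFrom-shift k (suc m ∸ k)) (≡.sym (sumP≡sumFrom f (suc k) (suc m))))
    where
    sumFrom-shift : ∀ k n → sumFrom (λ t → f (suc t)) k n ≡ sumFrom f (suc k) n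
    sumFrom-shift k zero = refl
    sumFrom-shift k (suc n) = ≡.cong (f (suc k) ++_) (sumFrom-shift (suc k) n)

  sumP-cons : ∀ {X} (f : ℕ → Poly X) k m → k ≤ m → sumP f k m ≡ f k ++ sumP f (suc k) m
  sumP-cons f k m le = ≡.trans (sumP≡sumFrom f k m) (≡.trans (≡.cong (sumFrom f k) (ℕ.+-∸-assoc 1 le))
    (≡.cong (f k ++_) (≡.sym (sumP≡sumFrom f (suc k) m))))

  sumP-empty : ∀ {X} (f : ℕ → Poly X) k m → m < k → sumP f k m ≡ []
  sumP-empty f k m lt = ≡.trans (sumP≡sumFrom f k m) (≡.cong (sumFrom f k) (ℕ.m≤n⇒m∸n≡0 lt))

  sumP-split : ∀ {X} (f : ℕ → Poly X) k j m → k ≤ suc j → j ≤ m → sumP f k m ≡ sumP f k j ++ sumP f (suc j) m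
  sumP-split f k j m kj jm = begin
    sumP f k m ≡⟨ sumP≡sumFrom f k m ⟩
    sumFrom f k (suc m ∸ k) ≡⟨ ≡.cong (sumFrom f k) count ⟩
    sumFrom f k ((suc j ∸ k) + (suc m ∸ suc j)) ≡⟨ sumFrom-+ f k (suc j ∸ k) (suc m ∸ suc j) ⟩
    sumFrom f k (suc j ∸ k) ++ sumFrom f (k + (suc j ∸ k)) (suc m ∸ suc j)
      ≡⟨ ≡.cong (λ z → sumFrom f k (suc j ∸ k) ++ sumFrom f z (suc m ∸ suc j)) (ℕ.m+[n∸m]≡n kj) ⟩
    sumFrom f k (suc j ∸ k) ++ sumFrom f (suc j) (suc m ∸ suc j)
      ≡⟨ ≡.sym (≡.cong₂ _++_ (sumP≡sumFrom f k j) (sumP≡sumFrom f (suc j) m)) ⟩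
    sumP f k j ++ sumP f (suc j) m ∎
    where
    open ≡.≡-Reasoning
    count : suc m ∸ k ≡ (suc j ∸ k) + (suc m ∸ suc j)
    count = begin
      suc m ∸ k ≡⟨ ≡.cong (_∸ k) (≡.sym (ℕ.m+[n∸m]≡n (s≤s jm))) ⟩
      (suc j + (suc m ∸ suc j)) ∸ k ≡⟨ ℕ.+-∸-comm (suc m ∸ suc j) kj ⟩
      (suc j ∸ k) + (suc m ∸ suc j) ∎

  sumP-snoc : ∀ {X} (f : ℕ → Poly X) k m → k ≤ suc m → sumP f k (suc m) ≡ sumP f k m ++ (f (suc m) ++ [])
  sumP-snoc f k m le = ≡.trans (sumP-split f k m (suc m) le (ℕ.n≤1+n m))
    (≡.cong (sumP f k m ++_) (≡.trans (sumP-cons f (suc m) (suc m) ℕ.≤-refl)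
      (≡.cong (f (suc m) ++_) (sumP-empty f (suc (suc m)) (suc m) ℕ.≤-refl))))

  module Sums {X : Set} (_≟_ : DecidableEquality X) where
    open Linear _≟_

    sumP-cong : ∀ {f g : ℕ → Poly X} k m → (∀ t → k ≤ t → t ≤ m → f t ≋ g t) → sumP f k m ≋ sumP g k m
    sumP-cong {f} {g} k m h with k ℕ.≤? suc m
    ... | yes le = ≋-trans (≋-reflexive (sumP≡sumFrom f k m)) (≋-trans (sumFrom-cong k (suc m ∸ k)
           (λ t kt tl → h t kt (ℕ.≤-pred (≡.subst (t <_) (ℕ.m+[n∸m]≡n le) tl)))) (≋-reflexive (≡.sym (sumP≡sumFrom g k m))))
      where
      sumFrom-cong : ∀ k n → (∀ t → k ≤ t → t < k + n → f t ≋ g t) → sumFrom f k n ≋ sumFrom g k n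
      sumFrom-cong k zero h = ≋-refl
      sumFrom-cong k (suc n) h = ++-cong (h k ℕ.≤-refl (ℕ.m<m+n k (s≤s z≤n)))
        (sumFrom-cong (suc k) n (λ t kt tl → h t (ℕ.<⇒≤ kt) (≡.subst (t <_) (≡.sym (ℕ.+-suc k n)) tl)))
    ... | no gt = ≋-reflexive (≡.trans (sumP-empty f k m lt) (≡.sym (sumP-empty g k m lt)))
      where lt = ℕ.≰⇒> (λ le → gt (ℕ.m≤n⇒m≤1+n le))

    uses-sumP : (ok : X → Set) (ok? : ∀ x → Dec (ok x)) → ∀ (f : ℕ → Poly X) k m →
                (∀ t → k ≤ t → t ≤ m → UsesOnly _≟_ ok (f t)) → UsesOnly _≟_ ok (sumP f k m)
    uses-sumP ok ok? f k m h with k ℕ.≤? suc m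
    ... | yes le = ≡.subst (UsesOnly _≟_ ok) (≡.sym (sumP≡sumFrom f k m)) (uses-sumFrom k (suc m ∸ k)
           (λ t kt tl → h t kt (ℕ.≤-pred (≡.subst (t <_) (ℕ.m+[n∸m]≡n le) tl))))
      where
      open Support ok ok?
      uses-sumFrom : ∀ k n → (∀ t → k ≤ t → t < k + n → Uses (f t)) → Uses (sumFrom f k n)
      uses-sumFrom k zero h = uses-[]
      uses-sumFrom k (suc n) h = uses-++ (f k) _ (h k ℕ.≤-refl (ℕ.m<m+n k (s≤s z≤n)))
        (uses-sumFrom (suc k) n (λ t kt tl → h t (ℕ.<⇒≤ kt) (≡.subst (t <_) (≡.sym (ℕ.+-suc k n)) tl)))
    ... | no gt = ≡.subst (UsesOnly _≟_ ok) (≡.sym (sumP-empty f k m (ℕ.≰⇒> (λ le → gt (ℕ.m≤n⇒m≤1+n le)))))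
                    (Support.uses-[] ok ok?)

    deg-sumP : ∀ (f : ℕ → Poly X) k m → (∀ t → DegLe _≟_ 1 (f t)) → DegLe _≟_ 1 (sumP f k m)
    deg-sumP f k m h = ≡.subst (DegLe _≟_ 1) (≡.sym (sumP≡sumFrom f k m)) (deg-sumFrom k (suc m ∸ k))
      where
      open Degree
      deg-sumFrom : ∀ k n → DegLe _≟_ 1 (sumFrom f k n)
      deg-sumFrom k zero = deg-[] 1
      deg-sumFrom k (suc n) = deg-++ 1 (f k) _ (h k) (deg-sumFrom (suc k) n)

  eval-sumP : ∀ {X Y} (_≟X_ : DecidableEquality X) (_≟Y_ : DecidableEquality Y) (σ : X → Poly Y) f k m →
              eval σ (sumP f k m) ≡ sumP (λ t → eval σ (f t)) k m
  eval-sumP _≟X_ _≟Y_ σ f k m =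
    ≡.trans (≡.cong (eval σ) (sumP≡sumFrom f k m)) (≡.trans (eval-sumFrom k (suc m ∸ k)) (≡.sym (sumP≡sumFrom _ k m)))
    where
    eval-sumFrom : ∀ k n → eval σ (sumFrom f k n) ≡ sumFrom (λ t → eval σ (f t)) k n
    eval-sumFrom k zero = refl
    eval-sumFrom k (suc n) = ≡.trans (Substitution.eval-++ _≟X_ _≟Y_ σ (f k) (sumFrom f (suc k) n))
      (≡.cong (eval σ (f k) ++_) (eval-sumFrom (suc k) n))

  negate : Carrier → Carrier
  negate x = (- 1#) *ᵣ x

  module _ where
    open SetoidReasoning setoid

    +-negateʳ : ∀ x → x +ᵣ negate x ≈ 0#
    +-negateʳ x = ≈-trans (+-congˡ (-1*x≈-x x)) (-‿inverseʳ x)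

    +-negateˡ : ∀ x → negate x +ᵣ x ≈ 0#
    +-negateˡ x = ≈-trans (+-comm _ _) (+-negateʳ x)

    negate-[x-y] : ∀ x y → negate (x +ᵣ negate y) ≈ negate x +ᵣ y
    negate-[x-y] x y = ≈-trans (distribˡ _ _ _) (+-congˡ (≈-trans (-1*x≈-x _) (≈-trans (-‿cong (-1*x≈-x y)) (-‿involutive y))))

    [a-b]+[b-c]≈a-c : ∀ a b c → (a +ᵣ negate b) +ᵣ (b +ᵣ negate c) ≈ a +ᵣ negate c
    [a-b]+[b-c]≈a-c a b c = begin
      (a +ᵣ negate b) +ᵣ (b +ᵣ negate c) ≈⟨ +-assoc _ _ _ ⟩
      a +ᵣ (negate b +ᵣ (b +ᵣ negate c)) ≈⟨ +-congˡ (≈-sym (+-assoc _ _ _)) ⟩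
      a +ᵣ ((negate b +ᵣ b) +ᵣ negate c) ≈⟨ +-congˡ (≈-trans (+-congʳ (+-negateˡ b)) (+-identityˡ _)) ⟩
      a +ᵣ negate c ∎

    [a-b]-[a-[b+x]]≈x : ∀ a b x → (a +ᵣ negate b) +ᵣ negate (a +ᵣ negate (b +ᵣ x)) ≈ x
    [a-b]-[a-[b+x]]≈x a b x = begin
      (a +ᵣ negate b) +ᵣ negate (a +ᵣ negate (b +ᵣ x)) ≈⟨ +-congˡ (negate-[x-y] _ _) ⟩
      (a +ᵣ negate b) +ᵣ (negate a +ᵣ (b +ᵣ x)) ≈⟨ interchange _ _ _ _ ⟩
      (a +ᵣ negate a) +ᵣ (negate b +ᵣ (b +ᵣ x)) ≈⟨ +-cong (+-negateʳ a) (≈-sym (+-assoc _ _ _)) ⟩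
      0# +ᵣ ((negate b +ᵣ b) +ᵣ x) ≈⟨ +-identityˡ _ ⟩
      (negate b +ᵣ b) +ᵣ x ≈⟨ ≈-trans (+-congʳ (+-negateˡ b)) (+-identityˡ _) ⟩
      x ∎

    [[x+a]-b]-[a-b]≈x : ∀ x a b → ((x +ᵣ a) +ᵣ negate b) +ᵣ negate (a +ᵣ negate b) ≈ x
    [[x+a]-b]-[a-b]≈x x a b = begin
      ((x +ᵣ a) +ᵣ negate b) +ᵣ negate (a +ᵣ negate b) ≈⟨ +-congˡ (negate-[x-y] _ _) ⟩
      ((x +ᵣ a) +ᵣ negate b) +ᵣ (negate a +ᵣ b) ≈⟨ interchange _ _ _ _ ⟩
      ((x +ᵣ a) +ᵣ negate a) +ᵣ (negate b +ᵣ b) ≈⟨ +-cong (+-assoc _ _ _) (+-negateˡ b) ⟩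
      (x +ᵣ (a +ᵣ negate a)) +ᵣ 0# ≈⟨ +-identityʳ _ ⟩
      x +ᵣ (a +ᵣ negate a) ≈⟨ ≈-trans (+-congˡ (+-negateʳ a)) (+-identityʳ _) ⟩
      x ∎

  module Differences {X : Set} (_≟_ : DecidableEquality X) where
    open Linear _≟_

    coeff--P : ∀ p q w → coeff _≟_ (p -P q) w ≈ coeff _≟_ p w +ᵣ negate (coeff _≟_ q w)
    coeff--P p q w = ≈-trans (coeff-++ p (-P q) w) (+-congˡ (coeff-· _ q w))

    -P-cong : ∀ {p p' q q'} → p ≋ p' → q ≋ q' → (p -P q) ≋ (p' -P q')
    -P-cong e f = ++-cong e (·P-cong (- 1#) f)

    p-p≋0 : ∀ p → (p -P p) ≋ []
    p-p≋0 p = ⟪ (λ w → ≈-trans (coeff--P p p w) (+-negateʳ _)) ⟫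

    [p-q]+[q-r]≋p-r : ∀ p q r → ((p -P q) ++ (q -P r)) ≋ (p -P r)
    [p-q]+[q-r]≋p-r p q r = ⟪ (λ w → ≈-trans (coeff-++ (p -P q) (q -P r) w)
       (≈-trans (+-cong (coeff--P p q w) (coeff--P q r w)) (≈-trans ([a-b]+[b-c]≈a-c _ _ _) (≈-sym (coeff--P p r w))))) ⟫

    [p-q]-[p-[q+r]]≋r : ∀ p q r → ((p -P q) -P (p -P (q ++ r))) ≋ r
    [p-q]-[p-[q+r]]≋r p q r = ⟪ (λ w → ≈-trans (coeff--P (p -P q) _ w)
       (≈-trans (+-cong (coeff--P p q w) (*-congˡ (≈-trans (coeff--P p _ w) (+-congˡ (*-congˡ (coeff-++ q r w))))))
        ([a-b]-[a-[b+x]]≈x _ _ _))) ⟫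

    [[r+p]-q]-[p-q]≋r : ∀ r p q → (((r ++ p) -P q) -P (p -P q)) ≋ r
    [[r+p]-q]-[p-q]≋r r p q = ⟪ (λ w → ≈-trans (coeff--P ((r ++ p) -P q) _ w)
       (≈-trans (+-cong (≈-trans (coeff--P (r ++ p) q w) (+-congʳ (coeff-++ r p w))) (*-congˡ (coeff--P p q w)))
        ([[x+a]-b]-[a-b]≈x _ _ _))) ⟫

  module SubstitutionDifferences {X Y : Set} (_≟X_ : DecidableEquality X) (_≟Y_ : DecidableEquality Y) where
    open Linear _≟Y_
    open Substitution _≟X_ _≟Y_

    eval--P : ∀ (σ : X → Poly Y) p q → eval σ (p -P q) ≋ (eval σ p -P eval σ q)
    eval--P σ p q = ≋-trans (≋-reflexive (eval-++ σ p (-P q))) (++-cong (≋-refl {eval σ p}) (eval-· σ (- 1#) q))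

    eval-var-var : ∀ (σ : X → Poly Y) x y → eval σ (var x -P var y) ≋ (σ x -P σ y)
    eval-var-var σ x y = ≋-trans (eval--P σ (var x) (var y)) (Differences.-P-cong _≟Y_ (eval-var σ x) (eval-var σ y))

module Letters {c ℓ} (R : CommutativeRing c ℓ) where

  open WithRing R
  open Polynomials R

  module LA = Linear ℕ._≟_
  module LB = Linear _≟BD_

  Dsum Bsum : ℕ → ℕ → Poly BD
  Dsum k m = sumP (λ t → var (d t)) k m
  Bsum k m = sumP (λ t → var (b t)) k m

  InA : ℕ → ℕ → Set
  InA n j = 1 ≤ j × j ≤ n

  InA? : ∀ n j → Dec (InA n j)
  InA? n j = (1 ℕ.≤? j) ×-dec (j ℕ.≤? n)

  InBD : ℕ → BD → Set
  InBD m x = 1 ≤ idx x × idx x ≤ m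

  InBD? : ∀ m x → Dec (InBD m x)
  InBD? m x = (1 ℕ.≤? idx x) ×-dec (idx x ℕ.≤? m)

  zeroAt-self : ∀ x → zeroAt x x ≡ []
  zeroAt-self x with x ≟BD x
  ... | yes _ = refl
  ... | no n = ⊥-elim (n refl)

  zeroAt-other : ∀ {x y} → y ≢ x → zeroAt x y ≡ var y
  zeroAt-other {x} {y} ne with y ≟BD x
  ... | yes e = ⊥-elim (ne e)
  ... | no _ = refl

  zeroAt-b-on-d : ∀ i t → zeroAt (b i) (d t) ≡ var (d t)
  zeroAt-b-on-d i t = zeroAt-other {b i} (λ ())

  zeroAt-d-on-b : ∀ i t → zeroAt (d i) (b t) ≡ var (b t)
  zeroAt-d-on-b i t = zeroAt-other {d i} (λ ())

  zeroAt-b-other : ∀ {i t} → t ≢ i → zeroAt (b i) (b t) ≡ var (b t)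
  zeroAt-b-other {i} ne = zeroAt-other {b i} (λ { refl → ne refl })

  zeroAt-d-other : ∀ {i t} → t ≢ i → zeroAt (d i) (d t) ≡ var (d t)
  zeroAt-d-other {i} ne = zeroAt-other {d i} (λ { refl → ne refl })

  σD-b< : ∀ {i k} → k < i → σD i (b k) ≡ var (b k)
  σD-b< lt rewrite <ᵇ-true lt = refl

  σD-b≡ : ∀ i → σD i (b i) ≡ var (b i) ++ var (b (suc i))
  σD-b≡ i rewrite <ᵇ-false (ℕ.<-irrefl {i} refl) | ≡ᵇ-true {i} refl = refl

  σD-b> : ∀ {i k} → i < k → σD i (b k) ≡ var (b (suc k))
  σD-b> {i} {k} lt rewrite <ᵇ-false (ℕ.<⇒≯ lt) | ≡ᵇ-false (λ (e : k ≡ i) → ℕ.<⇒≢ lt (≡.sym e)) = refl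

  σD-d< : ∀ {i k} → k < i → σD i (d k) ≡ var (d k)
  σD-d< lt rewrite <ᵇ-true lt = refl

  σD-d≥ : ∀ {i k} → i ≤ k → σD i (d k) ≡ var (d (suc k))
  σD-d≥ le rewrite <ᵇ-false (ℕ.≤⇒≯ le) = refl

  σB-b< : ∀ {i k} → k < i → σB i (b k) ≡ var (b k)
  σB-b< lt rewrite <ᵇ-true lt = refl

  σB-b≥ : ∀ {i k} → i ≤ k → σB i (b k) ≡ var (b (suc k))
  σB-b≥ le rewrite <ᵇ-false (ℕ.≤⇒≯ le) = refl

  σB-d< : ∀ {i k} → suc k < i → σB i (d k) ≡ var (d k)
  σB-d< lt rewrite <ᵇ-true lt = refl

  σB-d≡ : ∀ k → σB (suc k) (d k) ≡ var (d k) ++ var (d (suc k))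
  σB-d≡ k rewrite <ᵇ-false (ℕ.<-irrefl {suc k} refl) | ≡ᵇ-true {k} refl = refl

  σB-d> : ∀ {i k} → i ≤ k → σB i (d k) ≡ var (d (suc k))
  σB-d> {i} {k} le
    rewrite <ᵇ-false (λ (lt : suc k < i) → ℕ.<⇒≱ lt (ℕ.m≤n⇒m≤1+n le))
          | ≡ᵇ-false (λ (e : suc k ≡ i) → ℕ.<-irrefl refl (≡.subst (_≤ k) (≡.sym e) le)) = refl

  σab-even : ∀ m l → σab m (evenIx l) ≡ Dsum (suc l) m -P Bsum 1 (suc l)
  σab-even m l rewrite evenB-double (suc l) | ⌊double/2⌋ (suc l) = refl

  σab-odd : ∀ m l → σab m (oddIx l) ≡ Dsum (suc l) m -P Bsum 1 l
  σab-odd m l rewrite evenB-odd l | ⌊odd/2⌋ l = refl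

  mergeA : ℕ → ℕ → Poly ℕ
  mergeA i j = if j ≡ᵇ suc i then var i else var j

  skipA : ℕ → ℕ → Poly ℕ
  skipA i k = if k <ᵇ i then var k else var (2 + k)

  mergeA-next : ∀ i → mergeA i (suc i) ≡ var i
  mergeA-next i rewrite ≡ᵇ-true {i} refl = refl

  mergeA-other : ∀ {i j} → j ≢ suc i → mergeA i j ≡ var j
  mergeA-other ne rewrite ≡ᵇ-false ne = refl

  skipA-< : ∀ {i k} → k < i → skipA i k ≡ var k
  skipA-< lt rewrite <ᵇ-true lt = refl

  skipA-≮ : ∀ {i k} → ¬ k < i → skipA i k ≡ var (2 + k)
  skipA-≮ nl rewrite <ᵇ-false nl = refl

  killA-self : ∀ k → killA k k ≡ []
  killA-self k rewrite ≡ᵇ-true {k} refl = refl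

  killA-other : ∀ {k j} → j ≢ k → killA k j ≡ var j
  killA-other ne rewrite ≡ᵇ-false ne = refl

  τ-b : ∀ k → τ (b (suc k)) ≡ var (oddIx k) -P var (evenIx k)
  τ-b k = ≡.cong₂ (λ x y → var x -P var y) (≡.trans (≡.cong (λ z → k + suc z) (ℕ.+-identityʳ k)) (ℕ.+-suc k k)) (2*n≡n+n (suc k))

  τ-d : ∀ k → τ (d (suc k)) ≡ var (evenIx k) -P var (oddIx (suc k))
  τ-d k = ≡.cong₂ (λ x y → var x -P var y) (2*n≡n+n (suc k)) (≡.cong suc (2*n≡n+n (suc k)))

  eval-τ : ∀ {Y} (_≟_ : DecidableEquality Y) (σ : ℕ → Poly Y) x {p q} → τ x ≡ var p -P var q →
           Linear._≋_ _≟_ (eval σ (τ x)) (σ p -P σ q)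
  eval-τ _≟_ σ x {p} {q} e =
    Linear.≋-trans _≟_ (Linear.≋-reflexive _≟_ (≡.cong (eval σ) e)) (SubstitutionDifferences.eval-var-var ℕ._≟_ _≟_ σ p q)

module Forward {c ℓ} (R : CommutativeRing c ℓ) where

  open WithRing R
  open Polynomials R
  open Letters R
  open LB using (_≋_; ap; ≋-refl; ≋-sym; ≋-trans; ≋-reflexive; ++-cong; ++-identityʳ)
  open Differences _≟BD_ using (-P-cong)
  open SubstitutionDifferences _≟BD_ _≟BD_ using (eval--P)
  open Sums _≟BD_ using (sumP-cong; uses-sumP; deg-sumP)
  open SetoidReasoning LB.≋-setoid
  module SBB = Substitution _≟BD_ _≟BD_
  module SAB = Substitution ℕ._≟_ _≟BD_

  zeroD zeroB : ℕ → BD → Poly BD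
  zeroD i = zeroAt (d i)
  zeroB i = zeroAt (b i)

  eval-≡ : ∀ (σ : BD → Poly BD) {p q} → p ≡ q → eval σ p ≋ eval σ q
  eval-≡ σ e = ≋-reflexive (≡.cong (eval σ) e)

  eval-var-≡ : ∀ (σ : BD → Poly BD) x {r} → σ x ≡ r → eval σ (var x) ≋ r
  eval-var-≡ σ x e = ≋-trans (SBB.eval-var σ x) (≋-reflexive e)

  eval-++₃ : ∀ (σ : BD → Poly BD) p q r → eval σ (p ++ (q ++ r)) ≡ eval σ p ++ (eval σ q ++ eval σ r)
  eval-++₃ σ p q r = ≡.trans (SBB.eval-++ σ p (q ++ r)) (≡.cong (eval σ p ++_) (SBB.eval-++ σ q r))

  eval-sum-fixed : ∀ (σ : BD → Poly BD) (f : ℕ → BD) k m → (∀ t → k ≤ t → t ≤ m → σ (f t) ≡ var (f t)) →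
                   eval σ (sumP (λ t → var (f t)) k m) ≋ sumP (λ t → var (f t)) k m
  eval-sum-fixed σ f k m h = ≋-trans (≋-reflexive (eval-sumP _≟BD_ _≟BD_ σ (λ t → var (f t)) k m))
    (sumP-cong k m (λ t kt tm → eval-var-≡ σ (f t) (h t kt tm)))

  eval-sum-shifted : ∀ (σ : BD → Poly BD) (f : ℕ → BD) k m → (∀ t → k ≤ t → t ≤ m → σ (f t) ≡ var (f (suc t))) →
                     eval σ (sumP (λ t → var (f t)) k m) ≋ sumP (λ t → var (f t)) (suc k) (suc m)
  eval-sum-shifted σ f k m h = ≋-trans (≋-reflexive (eval-sumP _≟BD_ _≟BD_ σ (λ t → var (f t)) k m))
    (≋-trans (sumP-cong k m (λ t kt tm → eval-var-≡ σ (f t) (h t kt tm))) (≋-reflexive (sumP-shift (λ t → var (f t)) k m)))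

  zeroD-Dsum-spanning : ∀ a i' m → a ≤ suc i' → suc i' ≤ suc m →
                        eval (zeroD (suc i')) (Dsum a (suc m)) ≋ eval (σD (suc i')) (Dsum a m)
  zeroD-Dsum-spanning a i' m ai im = begin
    eval (zeroD i) (Dsum a (suc m))
      ≈⟨ eval-≡ (zeroD i) (≡.trans (sumP-split (λ t → var (d t)) a i' (suc m) ai (ℕ.m≤n⇒m≤1+n i'≤m))
                             (≡.cong (Dsum a i' ++_) (sumP-cons (λ t → var (d t)) i (suc m) im))) ⟩
    eval (zeroD i) (Dsum a i' ++ (var (d i) ++ Dsum (suc i) (suc m))) ≡⟨ eval-++₃ (zeroD i) (Dsum a i') (var (d i)) (Dsum (suc i) (suc m)) ⟩
    eval (zeroD i) (Dsum a i') ++ (eval (zeroD i) (var (d i)) ++ eval (zeroD i) (Dsum (suc i) (suc m)))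
      ≈⟨ ++-cong (eval-sum-fixed (zeroD i) d a i' (λ t _ tm → zeroD-other (≢-< (s≤s tm))))
        (++-cong (eval-var-≡ (zeroD i) (d i) (zeroAt-self (d i)))
                 (eval-sum-fixed (zeroD i) d (suc i) (suc m) (λ t it _ → zeroD-other (≢-> it)))) ⟩
    Dsum a i' ++ ([] ++ Dsum (suc i) (suc m))
      ≈⟨ ++-cong (≋-sym (eval-sum-fixed (σD i) d a i' (λ t _ tm → σD-d< (s≤s tm))))
                 (≋-sym (eval-sum-shifted (σD i) d i m (λ t it _ → σD-d≥ it))) ⟩
    eval (σD i) (Dsum a i') ++ eval (σD i) (Dsum i m) ≡⟨ ≡.sym (SBB.eval-++ (σD i) (Dsum a i') (Dsum i m)) ⟩
    eval (σD i) (Dsum a i' ++ Dsum i m) ≈⟨ eval-≡ (σD i) (≡.sym (sumP-split (λ t → var (d t)) a i' m ai i'≤m)) ⟩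
    eval (σD i) (Dsum a m) ∎
    where
    i = suc i'
    i'≤m = ℕ.≤-pred im
    zeroD-other = zeroAt-d-other

  zeroD-Dsum-above : ∀ a i m → i ≤ a → eval (zeroD i) (Dsum (suc a) (suc m)) ≋ eval (σD i) (Dsum a m)
  zeroD-Dsum-above a i m ia = ≋-trans (eval-sum-fixed (zeroD i) d (suc a) (suc m) (λ t at _ → zeroAt-d-other (≢-> (ℕ.≤-<-trans ia at))))
    (≋-sym (eval-sum-shifted (σD i) d a m (λ t at _ → σD-d≥ (ℕ.≤-trans ia at))))

  zeroD-Bsum-below : ∀ l i → l < i → eval (zeroD i) (Bsum 1 l) ≋ eval (σD i) (Bsum 1 l)
  zeroD-Bsum-below l i li = ≋-trans (eval-sum-fixed (zeroD i) b 1 l (λ t _ _ → zeroAt-d-on-b i t))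
    (≋-sym (eval-sum-fixed (σD i) b 1 l (λ t _ tl → σD-b< (ℕ.≤-<-trans tl li))))

  zeroD-Bsum-spanning : ∀ l i' → suc i' ≤ l → eval (zeroD (suc i')) (Bsum 1 (suc l)) ≋ eval (σD (suc i')) (Bsum 1 l)
  zeroD-Bsum-spanning l i' il = begin
    eval (zeroD i) (Bsum 1 (suc l)) ≈⟨ eval-sum-fixed (zeroD i) b 1 (suc l) (λ t _ _ → zeroAt-d-on-b i t) ⟩
    Bsum 1 (suc l)
      ≡⟨ ≡.trans (sumP-split (λ t → var (b t)) 1 i' (suc l) (s≤s z≤n) (ℕ.m≤n⇒m≤1+n (ℕ.<⇒≤ il)))
                 (≡.cong (Bsum 1 i' ++_) (≡.trans (sumP-cons (λ t → var (b t)) i (suc l) (ℕ.m≤n⇒m≤1+n il))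
                     (≡.cong (var (b i) ++_) (sumP-cons (λ t → var (b t)) (suc i) (suc l) (s≤s il))))) ⟩
    Bsum 1 i' ++ (var (b i) ++ (var (b (suc i)) ++ Bsum (suc (suc i)) (suc l)))
      ≡⟨ ≡.cong (Bsum 1 i' ++_) (≡.sym (List.++-assoc (var (b i)) (var (b (suc i))) _)) ⟩
    Bsum 1 i' ++ ((var (b i) ++ var (b (suc i))) ++ Bsum (suc (suc i)) (suc l))
       ≈⟨ ++-cong (≋-sym (eval-sum-fixed (σD i) b 1 i' (λ t _ tm → σD-b< (s≤s tm))))
            (++-cong (≋-sym (eval-var-≡ (σD i) (b i) (σD-b≡ i))) (≋-sym (eval-sum-shifted (σD i) b (suc i) l (λ t it _ → σD-b> it)))) ⟩
    eval (σD i) (Bsum 1 i') ++ (eval (σD i) (var (b i)) ++ eval (σD i) (Bsum (suc i) l))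
       ≡⟨ ≡.sym (eval-++₃ (σD i) (Bsum 1 i') (var (b i)) (Bsum (suc i) l)) ⟩
    eval (σD i) (Bsum 1 i' ++ (var (b i) ++ Bsum (suc i) l))
       ≈⟨ eval-≡ (σD i) (≡.sym (≡.trans (sumP-split (λ t → var (b t)) 1 i' l (s≤s z≤n) (ℕ.<⇒≤ il))
                                        (≡.cong (Bsum 1 i' ++_) (sumP-cons (λ t → var (b t)) i l il)))) ⟩
    eval (σD i) (Bsum 1 l) ∎
    where
    i = suc i'

  zeroB-Dsum-spanning : ∀ a i m → 1 ≤ a → a < i → i ≤ suc m → eval (zeroB i) (Dsum a (suc m)) ≋ eval (σB i) (Dsum a m)
  zeroB-Dsum-spanning a (suc zero) m a≥1 (s≤s a≤0) im = ⊥-elim (ℕ.<-irrefl refl (ℕ.≤-trans a≥1 a≤0))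
  zeroB-Dsum-spanning a (suc (suc i'')) m a≥1 (s≤s ai) im = begin
    eval (zeroB i) (Dsum a (suc m)) ≈⟨ eval-sum-fixed (zeroB i) d a (suc m) (λ t _ _ → zeroAt-b-on-d i t) ⟩
    Dsum a (suc m)
      ≡⟨ ≡.trans (sumP-split (λ t → var (d t)) a i'' (suc m) ai (ℕ.≤-trans (ℕ.n≤1+n i'') i'≤sm))
                 (≡.cong (Dsum a i'' ++_) (≡.trans (sumP-cons (λ t → var (d t)) i' (suc m) i'≤sm)
                    (≡.cong (var (d i') ++_) (sumP-cons (λ t → var (d t)) i (suc m) im)))) ⟩
    Dsum a i'' ++ (var (d i') ++ (var (d i) ++ Dsum (suc i) (suc m)))
      ≡⟨ ≡.cong (Dsum a i'' ++_) (≡.sym (List.++-assoc (var (d i')) (var (d i)) _)) ⟩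
    Dsum a i'' ++ ((var (d i') ++ var (d i)) ++ Dsum (suc i) (suc m))
       ≈⟨ ++-cong (≋-sym (eval-sum-fixed (σB i) d a i'' (λ t _ tm → σB-d< (s≤s (s≤s tm)))))
            (++-cong (≋-sym (eval-var-≡ (σB i) (d i') (σB-d≡ i'))) (≋-sym (eval-sum-shifted (σB i) d i m (λ t it _ → σB-d> it)))) ⟩
    eval (σB i) (Dsum a i'') ++ (eval (σB i) (var (d i')) ++ eval (σB i) (Dsum i m))
       ≡⟨ ≡.sym (eval-++₃ (σB i) (Dsum a i'') (var (d i')) (Dsum i m)) ⟩
    eval (σB i) (Dsum a i'' ++ (var (d i') ++ Dsum i m))
       ≈⟨ eval-≡ (σB i) (≡.sym (≡.trans (sumP-split (λ t → var (d t)) a i'' m ai (ℕ.≤-trans (ℕ.n≤1+n i'') (ℕ.≤-pred im)))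
                                        (≡.cong (Dsum a i'' ++_) (sumP-cons (λ t → var (d t)) i' m (ℕ.≤-pred im))))) ⟩
    eval (σB i) (Dsum a m) ∎
    where
    i' = suc i''
    i = suc i'
    i'≤sm = ℕ.≤-trans (ℕ.n≤1+n i') im

  zeroB-Dsum-above : ∀ a i m → i ≤ a → eval (zeroB i) (Dsum (suc a) (suc m)) ≋ eval (σB i) (Dsum a m)
  zeroB-Dsum-above a i m ia = ≋-trans (eval-sum-fixed (zeroB i) d (suc a) (suc m) (λ t _ _ → zeroAt-b-on-d i t))
    (≋-sym (eval-sum-shifted (σB i) d a m (λ t at _ → σB-d> (ℕ.≤-trans ia at))))

  zeroB-Bsum-below : ∀ l i → l < i → eval (zeroB i) (Bsum 1 l) ≋ eval (σB i) (Bsum 1 l)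
  zeroB-Bsum-below l i li = ≋-trans (eval-sum-fixed (zeroB i) b 1 l (λ t _ tl → zeroAt-b-other (≢-< (ℕ.≤-<-trans tl li))))
    (≋-sym (eval-sum-fixed (σB i) b 1 l (λ t _ tl → σB-b< (ℕ.≤-<-trans tl li))))

  zeroB-Bsum-spanning : ∀ l i' → suc i' ≤ suc l → eval (zeroB (suc i')) (Bsum 1 (suc l)) ≋ eval (σB (suc i')) (Bsum 1 l)
  zeroB-Bsum-spanning l i' il = begin
    eval (zeroB i) (Bsum 1 (suc l))
      ≈⟨ eval-≡ (zeroB i) (≡.trans (sumP-split (λ t → var (b t)) 1 i' (suc l) (s≤s z≤n) (ℕ.m≤n⇒m≤1+n (ℕ.≤-pred il)))
                                   (≡.cong (Bsum 1 i' ++_) (sumP-cons (λ t → var (b t)) i (suc l) il))) ⟩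
    eval (zeroB i) (Bsum 1 i' ++ (var (b i) ++ Bsum (suc i) (suc l))) ≡⟨ eval-++₃ (zeroB i) (Bsum 1 i') (var (b i)) (Bsum (suc i) (suc l)) ⟩
    eval (zeroB i) (Bsum 1 i') ++ (eval (zeroB i) (var (b i)) ++ eval (zeroB i) (Bsum (suc i) (suc l)))
      ≈⟨ ++-cong (eval-sum-fixed (zeroB i) b 1 i' (λ t _ tm → zeroAt-b-other (≢-< (s≤s tm))))
        (++-cong (eval-var-≡ (zeroB i) (b i) (zeroAt-self (b i)))
                 (eval-sum-fixed (zeroB i) b (suc i) (suc l) (λ t it _ → zeroAt-b-other (≢-> it)))) ⟩
    Bsum 1 i' ++ ([] ++ Bsum (suc i) (suc l))
      ≈⟨ ++-cong (≋-sym (eval-sum-fixed (σB i) b 1 i' (λ t _ tm → σB-b< (s≤s tm))))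
                 (≋-sym (eval-sum-shifted (σB i) b i l (λ t it _ → σB-b≥ it))) ⟩
    eval (σB i) (Bsum 1 i') ++ eval (σB i) (Bsum i l) ≡⟨ ≡.sym (SBB.eval-++ (σB i) (Bsum 1 i') (Bsum i l)) ⟩
    eval (σB i) (Bsum 1 i' ++ Bsum i l) ≈⟨ eval-≡ (σB i) (≡.sym (sumP-split (λ t → var (b t)) 1 i' l (s≤s z≤n) (ℕ.≤-pred il))) ⟩
    eval (σB i) (Bsum 1 l) ∎
    where
    i = suc i'

  zeroD-Dsum-drop-head : ∀ i m → i ≤ suc m → eval (zeroD i) (Dsum i (suc m)) ≋ eval (zeroD i) (Dsum (suc i) (suc m))
  zeroD-Dsum-drop-head i m im = begin
    eval (zeroD i) (Dsum i (suc m)) ≈⟨ eval-≡ (zeroD i) (sumP-cons (λ t → var (d t)) i (suc m) im) ⟩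
    eval (zeroD i) (var (d i) ++ Dsum (suc i) (suc m)) ≡⟨ SBB.eval-++ (zeroD i) (var (d i)) (Dsum (suc i) (suc m)) ⟩
    eval (zeroD i) (var (d i)) ++ eval (zeroD i) (Dsum (suc i) (suc m))
      ≈⟨ ++-cong (eval-var-≡ (zeroD i) (d i) (zeroAt-self (d i))) (≋-refl {eval (zeroD i) (Dsum (suc i) (suc m))}) ⟩
    eval (zeroD i) (Dsum (suc i) (suc m)) ∎

  zeroB-Bsum-drop-last : ∀ i' → eval (zeroB (suc i')) (Bsum 1 (suc i')) ≋ eval (zeroB (suc i')) (Bsum 1 i')
  zeroB-Bsum-drop-last i' = begin
    eval (zeroB i) (Bsum 1 (suc i')) ≈⟨ eval-≡ (zeroB i) (sumP-snoc (λ t → var (b t)) 1 i' (s≤s z≤n)) ⟩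
    eval (zeroB i) (Bsum 1 i' ++ (var (b i) ++ [])) ≡⟨ eval-++₃ (zeroB i) (Bsum 1 i') (var (b i)) [] ⟩
    eval (zeroB i) (Bsum 1 i') ++ (eval (zeroB i) (var (b i)) ++ [])
      ≈⟨ ++-cong (≋-refl {eval (zeroB i) (Bsum 1 i')}) (++-cong (eval-var-≡ (zeroB i) (b i) (zeroAt-self (b i))) (≋-refl {[]})) ⟩
    eval (zeroB i) (Bsum 1 i') ++ [] ≈⟨ ++-identityʳ _ ⟩
    eval (zeroB i) (Bsum 1 i') ∎
    where i = suc i'

  σab-then : (BD → Poly BD) → ℕ → ℕ → Poly BD
  σab-then Z m k = eval Z (σab m k)

  eval-at-var : ∀ (ρ : ℕ → Poly BD) (S : ℕ → Poly ℕ) k {j} → S k ≡ var j → eval ρ (S k) ≋ ρ j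
  eval-at-var ρ S k {j} e = ≋-trans (≋-reflexive (≡.cong (eval ρ) e)) (SAB.eval-var ρ j)

  skip-related : ∀ (Z σ : BD → Poly BD) m j k {k'} a a' l l' →
                 eval Z (Dsum a (suc m)) ≋ eval σ (Dsum a' m) → eval Z (Bsum 1 l) ≋ eval σ (Bsum 1 l') →
                 skipA j k ≡ var k' → σab (suc m) k' ≡ Dsum a (suc m) -P Bsum 1 l → σab m k ≡ Dsum a' m -P Bsum 1 l' →
                 eval (σab-then Z (suc m)) (skipA j k) ≋ eval σ (σab m k)
  skip-related Z σ m j k {k'} a a' l l' Ds Bs skip e e' = begin
    eval (σab-then Z (suc m)) (skipA j k) ≈⟨ eval-at-var (σab-then Z (suc m)) (skipA j) k skip ⟩
    eval Z (σab (suc m) k') ≡⟨ ≡.cong (eval Z) e ⟩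
    eval Z (Dsum a (suc m) -P Bsum 1 l) ≈⟨ eval--P Z (Dsum a (suc m)) (Bsum 1 l) ⟩
    eval Z (Dsum a (suc m)) -P eval Z (Bsum 1 l) ≈⟨ -P-cong Ds Bs ⟩
    eval σ (Dsum a' m) -P eval σ (Bsum 1 l') ≈⟨ ≋-sym (eval--P σ (Dsum a' m) (Bsum 1 l')) ⟩
    eval σ (Dsum a' m -P Bsum 1 l') ≡⟨ ≡.cong (eval σ) (≡.sym e') ⟩
    eval σ (σab m k) ∎

  merge-invariant : ∀ (ρ : ℕ → Poly BD) j → ρ (suc j) ≋ ρ j → ∀ k → ρ k ≋ eval ρ (mergeA j k)
  merge-invariant ρ j e k with k ℕ.≟ suc j
  ... | yes refl = ≋-trans e (≋-sym (eval-at-var ρ (mergeA j) (suc j) (mergeA-next j)))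
  ... | no ne = ≋-sym (eval-at-var ρ (mergeA j) k (mergeA-other ne))

  -- After d_i ↦ 0 the images of a_{2i} and a_{2i+1} coincide; after b_i ↦ 0 those of a_{2i-1} and a_{2i} do.
  zeroD-identifies : ∀ m i' → suc i' ≤ suc m →
                     σab-then (zeroD (suc i')) (suc m) (oddIx (suc i')) ≋ σab-then (zeroD (suc i')) (suc m) (evenIx i')
  zeroD-identifies m i' im = begin
    eval (zeroD i) (σab (suc m) (oddIx i)) ≡⟨ ≡.cong (eval (zeroD i)) (σab-odd (suc m) i) ⟩
    eval (zeroD i) (Dsum (suc i) (suc m) -P Bsum 1 i) ≈⟨ eval--P (zeroD i) (Dsum (suc i) (suc m)) (Bsum 1 i) ⟩
    eval (zeroD i) (Dsum (suc i) (suc m)) -P eval (zeroD i) (Bsum 1 i) ≈⟨ -P-cong (≋-sym (zeroD-Dsum-drop-head i m im)) ≋-refl ⟩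
    eval (zeroD i) (Dsum i (suc m)) -P eval (zeroD i) (Bsum 1 i) ≈⟨ ≋-sym (eval--P (zeroD i) (Dsum i (suc m)) (Bsum 1 i)) ⟩
    eval (zeroD i) (Dsum i (suc m) -P Bsum 1 i) ≡⟨ ≡.cong (eval (zeroD i)) (≡.sym (σab-even (suc m) i')) ⟩
    eval (zeroD i) (σab (suc m) (evenIx i')) ∎
    where i = suc i'

  zeroB-identifies : ∀ m i' → σab-then (zeroB (suc i')) (suc m) (suc (oddIx i')) ≋ σab-then (zeroB (suc i')) (suc m) (oddIx i')
  zeroB-identifies m i' = begin
    eval (zeroB i) (σab (suc m) (suc (oddIx i'))) ≡⟨ ≡.cong (λ z → eval (zeroB i) (σab (suc m) z)) (≡.sym (evenIx≡suc-oddIx i')) ⟩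
    eval (zeroB i) (σab (suc m) (evenIx i')) ≡⟨ ≡.cong (eval (zeroB i)) (σab-even (suc m) i') ⟩
    eval (zeroB i) (Dsum i (suc m) -P Bsum 1 i) ≈⟨ eval--P (zeroB i) (Dsum i (suc m)) (Bsum 1 i) ⟩
    eval (zeroB i) (Dsum i (suc m)) -P eval (zeroB i) (Bsum 1 i) ≈⟨ -P-cong ≋-refl (zeroB-Bsum-drop-last i') ⟩
    eval (zeroB i) (Dsum i (suc m)) -P eval (zeroB i) (Bsum 1 i') ≈⟨ ≋-sym (eval--P (zeroB i) (Dsum i (suc m)) (Bsum 1 i')) ⟩
    eval (zeroB i) (Dsum i (suc m) -P Bsum 1 i') ≡⟨ ≡.cong (eval (zeroB i)) (≡.sym (σab-odd (suc m) i')) ⟩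
    eval (zeroB i) (σab (suc m) (oddIx i')) ∎
    where i = suc i'

  zeroD-skip : ∀ m i' → suc i' ≤ suc m → ∀ k → 1 ≤ k →
               eval (σab-then (zeroD (suc i')) (suc m)) (skipA (evenIx i') k) ≋ eval (σD (suc i')) (σab m k)
  zeroD-skip m i' im k k≥1 with parity k
  zeroD-skip m i' im .(zero + zero) () | even zero
  zeroD-skip m i' im .(evenIx l) _ | even (suc l) with suc l ℕ.<? suc i'
  ... | yes lt = skip-related (zeroD i) (σD i) m (evenIx i') (evenIx l) (suc l) (suc l) (suc l) (suc l)
                   (zeroD-Dsum-spanning (suc l) i' m (ℕ.<⇒≤ lt) im) (zeroD-Bsum-below (suc l) i lt)
                   (skipA-< (double-< lt)) (σab-even (suc m) l) (σab-even m l)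
    where i = suc i'
  ... | no nlt = skip-related (zeroD i) (σD i) m (evenIx i') (evenIx l) (suc (suc l)) (suc l) (suc (suc l)) (suc l)
                   (zeroD-Dsum-above (suc l) i m (ℕ.≮⇒≥ nlt)) (zeroD-Bsum-spanning (suc l) i' (ℕ.≮⇒≥ nlt))
                   (≡.trans (skipA-≮ (λ q → nlt (double-<⁻ q))) (≡.cong var (2+evenIx l))) (σab-even (suc m) (suc l)) (σab-even m l)
    where i = suc i'
  zeroD-skip m i' im .(oddIx l) _ | odd l with l ℕ.<? suc i'
  ... | yes lt = skip-related (zeroD i) (σD i) m (evenIx i') (oddIx l) (suc l) (suc l) l l
                   (zeroD-Dsum-spanning (suc l) i' m lt im) (zeroD-Bsum-below l i lt)
                   (skipA-< (oddIx<evenIx (ℕ.≤-pred lt))) (σab-odd (suc m) l) (σab-odd m l)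
    where i = suc i'
  ... | no nlt = skip-related (zeroD i) (σD i) m (evenIx i') (oddIx l) (suc (suc l)) (suc l) (suc l) l
                   (zeroD-Dsum-above (suc l) i m (ℕ.m≤n⇒m≤1+n (ℕ.≮⇒≥ nlt))) (zeroD-Bsum-spanning l i' (ℕ.≮⇒≥ nlt))
                   (≡.trans (skipA-≮ (oddIx≮evenIx (ℕ.≮⇒≥ nlt))) (≡.cong var (2+oddIx l))) (σab-odd (suc m) (suc l)) (σab-odd m l)
    where i = suc i'

  zeroB-skip : ∀ m i' → suc i' ≤ suc m → ∀ k → 1 ≤ k →
               eval (σab-then (zeroB (suc i')) (suc m)) (skipA (oddIx i') k) ≋ eval (σB (suc i')) (σab m k)
  zeroB-skip m i' im k k≥1 with parity k
  zeroB-skip m i' im .(zero + zero) () | even zero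
  zeroB-skip m i' im .(evenIx l) _ | even (suc l) with suc l ℕ.<? suc i'
  ... | yes lt = skip-related (zeroB i) (σB i) m (oddIx i') (evenIx l) (suc l) (suc l) (suc l) (suc l)
                   (zeroB-Dsum-spanning (suc l) i m (s≤s z≤n) lt im) (zeroB-Bsum-below (suc l) i lt)
                   (skipA-< (evenIx<oddIx (ℕ.≤-pred lt))) (σab-even (suc m) l) (σab-even m l)
    where i = suc i'
  ... | no nlt = skip-related (zeroB i) (σB i) m (oddIx i') (evenIx l) (suc (suc l)) (suc l) (suc (suc l)) (suc l)
                   (zeroB-Dsum-above (suc l) i m (ℕ.≮⇒≥ nlt)) (zeroB-Bsum-spanning (suc l) i' (ℕ.m≤n⇒m≤1+n (ℕ.≮⇒≥ nlt)))
                   (≡.trans (skipA-≮ (evenIx≮oddIx (ℕ.≤-pred (ℕ.≮⇒≥ nlt)))) (≡.cong var (2+evenIx l))) (σab-even (suc m) (suc l)) (σab-even m l)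
    where i = suc i'
  zeroB-skip m i' im .(oddIx l) _ | odd l with suc l ℕ.<? suc i'
  ... | yes lt = skip-related (zeroB i) (σB i) m (oddIx i') (oddIx l) (suc l) (suc l) l l
                   (zeroB-Dsum-spanning (suc l) i m (s≤s z≤n) lt im) (zeroB-Bsum-below l i (ℕ.<-trans (ℕ.n<1+n l) lt))
                   (skipA-< (oddIx-< (ℕ.≤-pred lt))) (σab-odd (suc m) l) (σab-odd m l)
    where i = suc i'
  ... | no nlt = skip-related (zeroB i) (σB i) m (oddIx i') (oddIx l) (suc (suc l)) (suc l) (suc l) l
                   (zeroB-Dsum-above (suc l) i m (ℕ.≮⇒≥ nlt)) (zeroB-Bsum-spanning l i' (ℕ.≮⇒≥ nlt))
                   (≡.trans (skipA-≮ (oddIx-≮ (ℕ.≤-pred (ℕ.≮⇒≥ nlt)))) (≡.cong var (2+oddIx l))) (σab-odd (suc m) (suc l)) (σab-odd m l)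
    where i = suc i'

  window-uses : ∀ m a l → 1 ≤ a → l ≤ m → UsesOnly _≟BD_ (InBD m) (Dsum a m -P Bsum 1 l)
  window-uses m a l a≥1 l≤m = uses--P (Dsum a m) (Bsum 1 l)
    (uses-sumP (InBD m) (InBD? m) (λ t → var (d t)) a m (λ t at tm → uses-var (d t) (ℕ.≤-trans a≥1 at , tm)))
    (uses-sumP (InBD m) (InBD? m) (λ t → var (b t)) 1 l (λ t t≥1 tl → uses-var (b t) (t≥1 , ℕ.≤-trans tl l≤m)))
    where open LB.Support (InBD m) (InBD? m)

  σab-uses : ∀ m j → InA (oddIx m) j → UsesOnly _≟BD_ (InBD m) (σab m j)
  σab-uses m j j∈ with parity j
  σab-uses m .(zero + zero) (() , _) | even zero
  σab-uses m .(evenIx l) (_ , j≤) | even (suc l) = ≡.subst (UsesOnly _≟BD_ (InBD m)) (≡.sym (σab-even m l))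
    (window-uses m (suc l) (suc l) (s≤s z≤n) (ℕ.≤-pred (double-<⁻ (ℕ.≤-<-trans j≤ (oddIx<evenIx {m} ℕ.≤-refl)))))
  σab-uses m .(oddIx l) (_ , j≤) | odd l = ≡.subst (UsesOnly _≟BD_ (InBD m)) (≡.sym (σab-odd m l))
    (window-uses m (suc l) l (s≤s z≤n) (double-≤⁻ (ℕ.≤-pred j≤)))

  window-deg : ∀ m a l → DegLe _≟BD_ 1 (Dsum a m -P Bsum 1 l)
  window-deg m a l = deg--P 1 (Dsum a m) (Bsum 1 l)
    (deg-sumP (λ t → var (d t)) a m (λ t → deg-var (d t))) (deg-sumP (λ t → var (b t)) 1 l (λ t → deg-var (b t)))
    where open LB.Degree

  σab-deg : ∀ m j → DegLe _≟BD_ 1 (σab m j)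
  σab-deg m zero = LB.Degree.deg-[] 1
  σab-deg m (suc j) with evenB (suc j)
  ... | true = window-deg m ⌊ suc j /2⌋ ⌊ suc j /2⌋
  ... | false = window-deg m (suc ⌊ suc j /2⌋) ⌊ suc j /2⌋

  module Image (P : ℕ → Poly ℕ) (sol : SolNC P) where
    private
      module CABB = Composition ℕ._≟_ _≟BD_ _≟BD_
      module CAAB = Composition ℕ._≟_ ℕ._≟_ _≟BD_

    uses-P : ∀ n → UsesOnly ℕ._≟_ (InA n) (P n)
    uses-P = proj₁ (proj₁ sol)

    h : ℕ → Poly BD
    h = Φab P

    h≡ : ∀ m → h m ≡ eval (σab m) (P (oddIx m))
    h≡ m = ≡.cong (λ z → eval (σab m) (P (suc z))) (2*n≡n+n m)

    -- If Z ∘ σab_{m+1} does not separate a_j from a_{j+1}, the Sol_NC relation of P_{2m+3} at j applies.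
    relation-through-merge : ∀ m (Z σ : BD → Poly BD) j → 1 ≤ j → j < 2 + oddIx m →
      (∀ k → σab-then Z (suc m) k ≋ eval (σab-then Z (suc m)) (mergeA j k)) →
      (∀ k → 1 ≤ k → eval (σab-then Z (suc m)) (skipA j k) ≋ eval σ (σab m k)) →
      eval Z (h (suc m)) ≋ eval σ (h m)
    relation-through-merge m Z σ j j≥1 j< merged skipped = begin
      eval Z (h (suc m)) ≡⟨ ≡.cong (eval Z) (≡.trans (h≡ (suc m)) (≡.cong (λ z → eval (σab (suc m)) (P z)) (≡.sym (2+oddIx m)))) ⟩
      eval Z (eval (σab (suc m)) P₊) ≈⟨ CABB.eval-∘ Z (σab (suc m)) P₊ ⟩
      eval ρ P₊ ≈⟨ SAB.eval-congˢ P₊ merged ⟩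
      eval (λ k → eval ρ (mergeA j k)) P₊ ≈⟨ ≋-sym (CAAB.eval-∘ ρ (mergeA j) P₊) ⟩
      eval ρ (eval (mergeA j) P₊) ≈⟨ SAB.eval-cong ρ {eval (mergeA j) P₊} {eval (skipA j) (P (oddIx m))} (LA.⟪ proj₂ sol (oddIx m) j j≥1 j< ⟫) ⟩
      eval ρ (eval (skipA j) (P (oddIx m))) ≈⟨ CAAB.eval-∘ ρ (skipA j) (P (oddIx m)) ⟩
      eval (λ k → eval ρ (skipA j k)) (P (oddIx m))
        ≈⟨ SAB.OnSupport.eval-congˢ-on (InA (oddIx m)) (InA? (oddIx m)) (P (oddIx m)) (uses-P (oddIx m)) (λ k k∈ → skipped k (proj₁ k∈)) ⟩
      eval (λ k → eval σ (σab m k)) (P (oddIx m)) ≈⟨ ≋-sym (CABB.eval-∘ σ (σab m) (P (oddIx m))) ⟩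
      eval σ (eval (σab m) (P (oddIx m))) ≡⟨ ≡.cong (eval σ) (≡.sym (h≡ m)) ⟩
      eval σ (h m) ∎
      where
      P₊ = P (2 + oddIx m)
      ρ = σab-then Z (suc m)

    zeroD-relation : ∀ m i' → suc i' ≤ suc m → eval (zeroD (suc i')) (h (suc m)) ≋ eval (σD (suc i')) (h m)
    zeroD-relation m i' im = relation-through-merge m (zeroD (suc i')) (σD (suc i')) (evenIx i') (s≤s z≤n)
      (s≤s (s≤s (≡.subst (_≤ oddIx m) (≡.sym (ℕ.+-suc i' i')) (s≤s (double-≤ (ℕ.≤-pred im))))))
      (merge-invariant _ (evenIx i') (zeroD-identifies m i' im)) (zeroD-skip m i' im)

    zeroB-relation : ∀ m i' → suc i' ≤ suc m → eval (zeroB (suc i')) (h (suc m)) ≋ eval (σB (suc i')) (h m)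
    zeroB-relation m i' im = relation-through-merge m (zeroB (suc i')) (σB (suc i')) (oddIx i') (s≤s z≤n)
      (s≤s (s≤s (ℕ.m≤n⇒m≤1+n (double-≤ (ℕ.≤-pred im)))))
      (merge-invariant _ (oddIx i') (zeroB-identifies m i')) (zeroB-skip m i' im)

    uses-h : ∀ m → UsesOnly _≟BD_ (InBD m) (h m)
    uses-h m = ≡.subst (UsesOnly _≟BD_ (InBD m)) (≡.sym (h≡ m))
      (SAB.OnSupport.uses-eval (InA (oddIx m)) (InA? (oddIx m)) (InBD m) (InBD? m) {σab m} (P (oddIx m)) (uses-P (oddIx m)) (σab-uses m))

    deg-h : ∃ λ D → ∀ m → DegLe _≟BD_ D (h m)
    deg-h = D , λ m → ≡.subst (DegLe _≟BD_ D) (≡.sym (h≡ m)) (SAB.deg-eval {σab m} D (P (oddIx m)) (degP (oddIx m)) (σab-deg m))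
      where
      D = proj₁ (proj₁ (proj₂ (proj₁ sol)))
      degP = proj₂ (proj₁ (proj₂ (proj₁ sol)))

    eval-h-congˢ : ∀ m {σ σ' : BD → Poly BD} → (∀ x → InBD m x → σ x ≋ σ' x) → eval σ (h m) ≋ eval σ' (h m)
    eval-h-congˢ m = SBB.OnSupport.eval-congˢ-on (InBD m) (InBD? m) (h m) (uses-h m)

    eval-h-id : ∀ m {σ : BD → Poly BD} → (∀ x → InBD m x → σ x ≡ var x) → eval σ (h m) ≋ h m
    eval-h-id m e = ≋-trans (eval-h-congˢ m (λ x x∈ → ≋-reflexive (e x x∈))) (eval-var-id _≟BD_ (h m))

    zeroD-last : ∀ m → eval (zeroD (suc m)) (h (suc m)) ≋ h m
    zeroD-last m = ≋-trans (zeroD-relation m m ℕ.≤-refl) (eval-h-id m fixed)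
      where
      fixed : ∀ x → InBD m x → σD (suc m) x ≡ var x
      fixed (inj₁ k) (_ , k≤m) = σD-b< (s≤s k≤m)
      fixed (inj₂ k) (_ , k≤m) = σD-d< (s≤s k≤m)

    stable : ∀ m → eval (zeroB (suc m)) (eval (zeroD (suc m)) (h (suc m))) ≋ h m
    stable m = ≋-trans (SBB.eval-cong (zeroB (suc m)) (zeroD-last m)) (eval-h-id m fixed)
      where
      fixed : ∀ x → InBD m x → zeroB (suc m) x ≡ var x
      fixed (inj₁ k) (_ , k≤m) = zeroAt-b-other (≢-< (s≤s k≤m))
      fixed (inj₂ k) _ = zeroAt-b-on-d (suc m) k

    zeroB-first : ∀ m → eval (zeroB 1) (h (suc m)) ≋ eval shiftBD (h m)
    zeroB-first m = ≋-trans (zeroB-relation m 0 (s≤s z≤n)) (eval-h-congˢ m shifted)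
      where
      shifted : ∀ x → InBD m x → σB 1 x ≋ shiftBD x
      shifted (inj₁ k) (k≥1 , _) = ≋-reflexive (σB-b≥ k≥1)
      shifted (inj₂ k) (k≥1 , _) = ≋-reflexive (σB-d> k≥1)

    solNC' : SolNC' h
    solNC' = (uses-h , deg-h , (λ m → ap (stable m)))
           , (λ { m (suc i') _ i<m → ap (zeroD-relation m i' (ℕ.m≤n⇒m≤1+n (ℕ.≤-pred i<m))) })
           , (λ m → ap (zeroD-last m))
           , (λ { m (suc i') _ i≤m → ap (zeroB-relation m i' i≤m) })
           , (λ m → ap (zeroB-first m))

module Backward {c ℓ} (R : CommutativeRing c ℓ) where

  open WithRing R
  open Polynomials R
  open Letters R
  open LA using (_≋_; ap; ≋-sym; ≋-trans; ≋-reflexive; ++-cong)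
  open Differences ℕ._≟_ using (-P-cong; p-p≋0; [p-q]+[q-r]≋p-r)
  open SubstitutionDifferences ℕ._≟_ ℕ._≟_ using (eval--P)
  open SetoidReasoning LA.≋-setoid
  module SBA = Substitution _≟BD_ ℕ._≟_
  module SAA = Substitution ℕ._≟_ ℕ._≟_

  Φba-odd : ∀ h m → Φba h (oddIx m) ≡ eval τ (h m)
  Φba-odd h m rewrite evenB-odd m | ⌊odd/2⌋ m = refl

  Φba-even : ∀ h m → Φba h (m + m) ≡ eval (killA (oddIx m)) (eval τ (h m))
  Φba-even h m rewrite evenB-double m | ⌊double/2⌋ m = refl

  τ-then : (ℕ → Poly ℕ) → BD → Poly ℕ
  τ-then σ x = eval σ (τ x)

  τ-then² : (ℕ → Poly ℕ) → (ℕ → Poly ℕ) → BD → Poly ℕ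
  τ-then² σ₁ σ₂ x = eval σ₁ (eval σ₂ (τ x))

  eval-var-≡ : ∀ (σ : ℕ → Poly ℕ) j {r} → σ j ≡ r → eval σ (var j) ≋ r
  eval-var-≡ σ j e = ≋-trans (SAA.eval-var σ j) (≋-reflexive e)

  eval-via-var : ∀ (σ₁ σ₂ : ℕ → Poly ℕ) j {j' r} → σ₂ j ≡ var j' → σ₁ j' ≡ r → eval σ₁ (σ₂ j) ≋ r
  eval-via-var σ₁ σ₂ j {j'} e₁ e₂ = ≋-trans (≋-reflexive (≡.cong (eval σ₁) e₁)) (eval-var-≡ σ₁ j' e₂)

  eval-via-[] : ∀ (σ₁ σ₂ : ℕ → Poly ℕ) j → σ₂ j ≡ [] → eval σ₁ (σ₂ j) ≋ []
  eval-via-[] σ₁ σ₂ j e = ≋-reflexive (≡.cong (eval σ₁) e)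

  eval-along : ∀ (ρ : BD → Poly ℕ) (σ : BD → Poly BD) x {y r} → σ x ≡ var y → ρ y ≋ r → eval ρ (σ x) ≋ r
  eval-along ρ σ x {y} e e' = ≋-trans (≋-reflexive (≡.cong (eval ρ) e)) (≋-trans (SBA.eval-var ρ y) e')

  τ-then-≡ : ∀ (σ : ℕ → Poly ℕ) x {p q r₁ r₂} → τ x ≡ var p -P var q → σ p ≡ r₁ → σ q ≡ r₂ → τ-then σ x ≋ (r₁ -P r₂)
  τ-then-≡ σ x e e₁ e₂ = ≋-trans (eval-τ ℕ._≟_ σ x e) (≋-reflexive (≡.cong₂ _-P_ e₁ e₂))

  τ-then²-≡ : ∀ (σ₁ σ₂ : ℕ → Poly ℕ) x {p q} → τ x ≡ var p -P var q →
              τ-then² σ₁ σ₂ x ≋ (eval σ₁ (σ₂ p) -P eval σ₁ (σ₂ q))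
  τ-then²-≡ σ₁ σ₂ x {p} {q} e =
    ≋-trans (SAA.eval-cong σ₁ (τ-then-≡ σ₂ x e refl refl)) (eval--P σ₁ (σ₂ p) (σ₂ q))

  mergeA-odd-next : ∀ j → mergeA (oddIx j) (evenIx j) ≡ var (oddIx j)
  mergeA-odd-next j = ≡.trans (≡.cong (mergeA (oddIx j)) (evenIx≡suc-oddIx j)) (mergeA-next (oddIx j))

  mergeA-odd-other : ∀ j a → a ≢ evenIx j → mergeA (oddIx j) a ≡ var a
  mergeA-odd-other j a ne = mergeA-other (λ e → ne (≡.trans e (≡.sym (evenIx≡suc-oddIx j))))

  mergeA-even-other : ∀ j a → a ≢ oddIx (suc j) → mergeA (evenIx j) a ≡ var a
  mergeA-even-other j a = mergeA-other

  oddIx≢oddIx : ∀ {k j} → k ≢ j → oddIx k ≢ oddIx j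
  oddIx≢oddIx ne e = ne (oddIx-injective e)

  evenIx≢evenIx : ∀ {k j} → k ≢ j → evenIx k ≢ evenIx j
  evenIx≢evenIx ne e = ne (evenIx-injective e)

  mergeA-killA-comm : ∀ i K → suc i < K → ∀ j → eval (mergeA i) (killA K j) ≋ eval (killA K) (mergeA i j)
  mergeA-killA-comm i K i<K j with j ℕ.≟ K
  ... | yes refl = ≋-trans (≋-reflexive (≡.cong (eval (mergeA i)) (killA-self K)))
         (≋-sym (eval-via-var (killA K) (mergeA i) K (mergeA-other (≢-> i<K)) (killA-self K)))
  ... | no j≢K = ≋-trans (eval-via-var (mergeA i) (killA K) j (killA-other j≢K) refl) (≋-sym merge-unkilled)
    where
    merge-unkilled : eval (killA K) (mergeA i j) ≋ mergeA i j
    merge-unkilled with j ℕ.≟ suc i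
    ... | yes refl = eval-via-var (killA K) (mergeA i) (suc i) (mergeA-next i) (≡.trans (killA-other (≢-< (ℕ.<-trans (ℕ.n<1+n i) i<K))) (≡.sym (mergeA-next i)))
    ... | no ne = eval-via-var (killA K) (mergeA i) j (mergeA-other ne) (≡.trans (killA-other j≢K) (≡.sym (mergeA-other ne)))

  killA-skipA-comm : ∀ i K → i < K → ∀ j → eval (killA (2 + K)) (skipA i j) ≋ eval (skipA i) (killA K j)
  killA-skipA-comm i K i<K j with j ℕ.<? i
  ... | yes j<i = ≋-trans (eval-via-var (killA (2 + K)) (skipA i) j (skipA-< j<i) (killA-other (≢-< (ℕ.<-trans j<i (ℕ.<-trans i<K (ℕ.m<n+m K (s≤s z≤n)))))))
                    (≋-sym (eval-via-var (skipA i) (killA K) j (killA-other (≢-< (ℕ.<-trans j<i i<K))) (skipA-< j<i)))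
  ... | no j≮i with j ℕ.≟ K
  ...   | yes refl = ≋-trans (eval-via-var (killA (2 + K)) (skipA i) K (skipA-≮ j≮i) (killA-self (2 + K)))
                       (≋-sym (eval-via-[] (skipA i) (killA K) K (killA-self K)))
  ...   | no j≢K = ≋-trans (eval-via-var (killA (2 + K)) (skipA i) j (skipA-≮ j≮i) (killA-other (λ e → j≢K (ℕ.suc-injective (ℕ.suc-injective e)))))
                     (≋-sym (eval-via-var (skipA i) (killA K) j (killA-other j≢K) (skipA-≮ j≮i)))

  module MergeOdd (j : ℕ) where
    private
      sw = mergeA (oddIx j)
      sh = skipA (oddIx j)

    kills-b : τ-then sw (b (suc j)) ≋ []
    kills-b = ≋-trans (τ-then-≡ sw (b (suc j)) (τ-b j) (mergeA-odd-other j (oddIx j) (oddIx≢evenIx {j} {j})) (mergeA-odd-next j))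
                      (p-p≋0 (var (oddIx j)))

    after-σB-merged : ∀ k → suc k ≡ j → eval (τ-then sw) (σB (suc j) (d (suc k))) ≋ τ-then sh (d (suc k))
    after-σB-merged k refl = begin
      eval (τ-then sw) (σB (suc (suc k)) (d (suc k))) ≡⟨ ≡.cong (eval (τ-then sw)) (σB-d≡ (suc k)) ⟩
      eval (τ-then sw) (var (d (suc k)) ++ var (d (suc (suc k)))) ≡⟨ SBA.eval-++ (τ-then sw) (var (d (suc k))) (var (d (suc (suc k)))) ⟩
      eval (τ-then sw) (var (d (suc k))) ++ eval (τ-then sw) (var (d (suc (suc k))))
        ≈⟨ ++-cong (≋-trans (SBA.eval-var (τ-then sw) (d (suc k)))
                      (τ-then-≡ sw (d (suc k)) (τ-d k) (mergeA-odd-other (suc k) (evenIx k) (evenIx≢evenIx (≢-< (ℕ.n<1+n k))))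
                                                      (mergeA-odd-other (suc k) (oddIx (suc k)) (oddIx≢evenIx {suc k} {suc k}))))
                   (≋-trans (SBA.eval-var (τ-then sw) (d (suc (suc k))))
                      (τ-then-≡ sw (d (suc (suc k))) (τ-d (suc k)) (mergeA-odd-next (suc k))
                                                                 (mergeA-odd-other (suc k) (oddIx (suc (suc k))) (oddIx≢evenIx {suc (suc k)} {suc k})))) ⟩
      (var (evenIx k) -P var (oddIx (suc k))) ++ (var (oddIx (suc k)) -P var (oddIx (suc (suc k))))
        ≈⟨ [p-q]+[q-r]≋p-r (var (evenIx k)) (var (oddIx (suc k))) (var (oddIx (suc (suc k)))) ⟩
      var (evenIx k) -P var (oddIx (suc (suc k)))
        ≈⟨ ≋-sym (τ-then-≡ sh (d (suc k)) (τ-d k) (skipA-< (evenIx<oddIx (ℕ.n<1+n k)))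
                             (≡.trans (skipA-≮ (oddIx-≮ {suc k} {suc k} ℕ.≤-refl)) (≡.cong var (2+oddIx (suc k))))) ⟩
      τ-then sh (d (suc k)) ∎

    after-σB : ∀ x → 1 ≤ idx x → eval (τ-then sw) (σB (suc j) x) ≋ τ-then sh x
    after-σB (inj₁ zero) ()
    after-σB (inj₂ zero) ()
    after-σB (inj₁ (suc k)) _ with suc k ℕ.<? suc j
    ... | yes lt = eval-along (τ-then sw) (σB (suc j)) (b (suc k)) (σB-b< lt)
          (≋-trans (τ-then-≡ sw (b (suc k)) (τ-b k) (mergeA-odd-other j (oddIx k) (oddIx≢evenIx {k} {j}))
                                                  (mergeA-odd-other j (evenIx k) (evenIx≢evenIx (≢-< (ℕ.≤-pred lt)))))
            (≋-sym (τ-then-≡ sh (b (suc k)) (τ-b k) (skipA-< (oddIx-< (ℕ.≤-pred lt))) (skipA-< (evenIx<oddIx (ℕ.≤-pred lt))))))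
    ... | no nlt = eval-along (τ-then sw) (σB (suc j)) (b (suc k)) (σB-b≥ (ℕ.≮⇒≥ nlt))
          (≋-trans (τ-then-≡ sw (b (suc (suc k))) (τ-b (suc k)) (mergeA-odd-other j (oddIx (suc k)) (oddIx≢evenIx {suc k} {j}))
                                                              (mergeA-odd-other j (evenIx (suc k)) (evenIx≢evenIx (≢-> (ℕ.≮⇒≥ nlt)))))
            (≋-sym (τ-then-≡ sh (b (suc k)) (τ-b k) (≡.trans (skipA-≮ (oddIx-≮ (ℕ.≤-pred (ℕ.≮⇒≥ nlt)))) (≡.cong var (2+oddIx k)))
                                                    (≡.trans (skipA-≮ (evenIx≮oddIx (ℕ.≤-pred (ℕ.≮⇒≥ nlt)))) (≡.cong var (2+evenIx k))))))
    after-σB (inj₂ (suc k)) _ with ℕ.<-cmp (suc k) j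
    ... | tri< lt _ _ = eval-along (τ-then sw) (σB (suc j)) (d (suc k)) (σB-d< (s≤s lt))
          (≋-trans (τ-then-≡ sw (d (suc k)) (τ-d k) (mergeA-odd-other j (evenIx k) (evenIx≢evenIx (≢-< (ℕ.<-trans (ℕ.n<1+n k) lt))))
                                                  (mergeA-odd-other j (oddIx (suc k)) (oddIx≢evenIx {suc k} {j})))
            (≋-sym (τ-then-≡ sh (d (suc k)) (τ-d k) (skipA-< (evenIx<oddIx (ℕ.<-trans (ℕ.n<1+n k) lt))) (skipA-< (oddIx-< lt)))))
    ... | tri≈ _ e _ = after-σB-merged k e
    ... | tri> _ _ gt = eval-along (τ-then sw) (σB (suc j)) (d (suc k)) (σB-d> gt)
          (≋-trans (τ-then-≡ sw (d (suc (suc k))) (τ-d (suc k)) (mergeA-odd-other j (evenIx (suc k)) (evenIx≢evenIx (≢-> gt)))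
                                                              (mergeA-odd-other j (oddIx (suc (suc k))) (oddIx≢evenIx {suc (suc k)} {j})))
            (≋-sym (τ-then-≡ sh (d (suc k)) (τ-d k) (≡.trans (skipA-≮ (evenIx≮oddIx (ℕ.≤-pred gt))) (≡.cong var (2+evenIx k)))
                                                    (≡.trans (skipA-≮ (oddIx-≮ (ℕ.<⇒≤ gt))) (≡.cong var (2+oddIx (suc k)))))))

  module MergeEven (j : ℕ) where
    private
      sw = mergeA (evenIx j)
      sh = skipA (evenIx j)

    kills-d : τ-then sw (d (suc j)) ≋ []
    kills-d = ≋-trans (τ-then-≡ sw (d (suc j)) (τ-d j) (mergeA-even-other j (evenIx j) (evenIx≢oddIx {j} {suc j})) (mergeA-next (evenIx j)))
                      (p-p≋0 (var (evenIx j)))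

    after-σD-merged : ∀ k → k ≡ j → eval (τ-then sw) (σD (suc j) (b (suc k))) ≋ τ-then sh (b (suc k))
    after-σD-merged k refl = begin
      eval (τ-then sw) (σD (suc k) (b (suc k))) ≡⟨ ≡.cong (eval (τ-then sw)) (σD-b≡ (suc k)) ⟩
      eval (τ-then sw) (var (b (suc k)) ++ var (b (suc (suc k)))) ≡⟨ SBA.eval-++ (τ-then sw) (var (b (suc k))) (var (b (suc (suc k)))) ⟩
      eval (τ-then sw) (var (b (suc k))) ++ eval (τ-then sw) (var (b (suc (suc k))))
        ≈⟨ ++-cong (≋-trans (SBA.eval-var (τ-then sw) (b (suc k)))
                      (τ-then-≡ sw (b (suc k)) (τ-b k) (mergeA-even-other k (oddIx k) (oddIx≢oddIx (≢-< (ℕ.n<1+n k))))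
                                                      (mergeA-even-other k (evenIx k) (evenIx≢oddIx {k} {suc k}))))
                   (≋-trans (SBA.eval-var (τ-then sw) (b (suc (suc k))))
                      (τ-then-≡ sw (b (suc (suc k))) (τ-b (suc k)) (mergeA-next (evenIx k))
                                                                 (mergeA-even-other k (evenIx (suc k)) (evenIx≢oddIx {suc k} {suc k})))) ⟩
      (var (oddIx k) -P var (evenIx k)) ++ (var (evenIx k) -P var (evenIx (suc k)))
        ≈⟨ [p-q]+[q-r]≋p-r (var (oddIx k)) (var (evenIx k)) (var (evenIx (suc k))) ⟩
      var (oddIx k) -P var (evenIx (suc k))
        ≈⟨ ≋-sym (τ-then-≡ sh (b (suc k)) (τ-b k) (skipA-< (oddIx<evenIx {k} {k} ℕ.≤-refl))
                             (≡.trans (skipA-≮ (evenIx-≮ {k} {k} ℕ.≤-refl)) (≡.cong var (2+evenIx k)))) ⟩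
      τ-then sh (b (suc k)) ∎

    after-σD : ∀ x → 1 ≤ idx x → eval (τ-then sw) (σD (suc j) x) ≋ τ-then sh x
    after-σD (inj₁ zero) ()
    after-σD (inj₂ zero) ()
    after-σD (inj₁ (suc k)) _ with ℕ.<-cmp k j
    ... | tri< lt _ _ = eval-along (τ-then sw) (σD (suc j)) (b (suc k)) (σD-b< (s≤s lt))
          (≋-trans (τ-then-≡ sw (b (suc k)) (τ-b k) (mergeA-even-other j (oddIx k) (oddIx≢oddIx (≢-< (ℕ.<-trans lt (ℕ.n<1+n j)))))
                                                  (mergeA-even-other j (evenIx k) (evenIx≢oddIx {k} {suc j})))
            (≋-sym (τ-then-≡ sh (b (suc k)) (τ-b k) (skipA-< (oddIx<evenIx (ℕ.<⇒≤ lt))) (skipA-< (evenIx-< lt)))))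
    ... | tri≈ _ e _ = after-σD-merged k e
    ... | tri> _ _ gt = eval-along (τ-then sw) (σD (suc j)) (b (suc k)) (σD-b> (s≤s gt))
          (≋-trans (τ-then-≡ sw (b (suc (suc k))) (τ-b (suc k)) (mergeA-even-other j (oddIx (suc k)) (oddIx≢oddIx (≢-> (s≤s gt))))
                                                              (mergeA-even-other j (evenIx (suc k)) (evenIx≢oddIx {suc k} {suc j})))
            (≋-sym (τ-then-≡ sh (b (suc k)) (τ-b k) (≡.trans (skipA-≮ (oddIx≮evenIx gt)) (≡.cong var (2+oddIx k)))
                                                    (≡.trans (skipA-≮ (evenIx-≮ (ℕ.<⇒≤ gt))) (≡.cong var (2+evenIx k))))))
    after-σD (inj₂ (suc k)) _ with suc k ℕ.<? suc j
    ... | yes lt = eval-along (τ-then sw) (σD (suc j)) (d (suc k)) (σD-d< lt)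
          (≋-trans (τ-then-≡ sw (d (suc k)) (τ-d k) (mergeA-even-other j (evenIx k) (evenIx≢oddIx {k} {suc j}))
                                                  (mergeA-even-other j (oddIx (suc k)) (oddIx≢oddIx (≢-< lt))))
            (≋-sym (τ-then-≡ sh (d (suc k)) (τ-d k) (skipA-< (evenIx-< (ℕ.≤-pred lt))) (skipA-< (oddIx<evenIx (ℕ.≤-pred lt))))))
    ... | no nlt = eval-along (τ-then sw) (σD (suc j)) (d (suc k)) (σD-d≥ (ℕ.≮⇒≥ nlt))
          (≋-trans (τ-then-≡ sw (d (suc (suc k))) (τ-d (suc k)) (mergeA-even-other j (evenIx (suc k)) (evenIx≢oddIx {suc k} {suc j}))
                                                              (mergeA-even-other j (oddIx (suc (suc k))) (oddIx≢oddIx (≢-> (s≤s (ℕ.≮⇒≥ nlt))))))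
            (≋-sym (τ-then-≡ sh (d (suc k)) (τ-d k) (≡.trans (skipA-≮ (evenIx-≮ (ℕ.≤-pred (ℕ.≮⇒≥ nlt)))) (≡.cong var (2+evenIx k)))
                                                    (≡.trans (skipA-≮ (oddIx≮evenIx (ℕ.≮⇒≥ nlt))) (≡.cong var (2+oddIx (suc k)))))))

  mergeTop skipTop killTop : ℕ → BD → Poly ℕ
  mergeTop m = τ-then² (mergeA (oddIx m)) (killA (oddIx (suc m)))
  skipTop m = τ-then² (skipA (oddIx m)) (killA (oddIx m))
  killTop m = τ-then² (killA (evenIx m)) (killA (oddIx (suc m)))

  mergeTop-kills-b : ∀ m → mergeTop m (b (suc m)) ≋ []
  mergeTop-kills-b m = ≋-trans (τ-then²-≡ (mergeA (oddIx m)) (killA (oddIx (suc m))) (b (suc m)) (τ-b m))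
    (≋-trans (-P-cong (eval-via-var (mergeA (oddIx m)) (killA (oddIx (suc m))) (oddIx m) (killA-other (oddIx≢oddIx (≢-< (ℕ.n<1+n m))))
                                    (mergeA-odd-other m (oddIx m) (oddIx≢evenIx {m} {m})))
                      (eval-via-var (mergeA (oddIx m)) (killA (oddIx (suc m))) (evenIx m) (killA-other (evenIx≢oddIx {m} {suc m}))
                                    (mergeA-odd-next m)))
             (p-p≋0 (var (oddIx m))))

  mergeTop-after-σB-merged : ∀ m k → suc k ≡ m → eval (mergeTop m) (σB (suc m) (d (suc k))) ≋ skipTop m (d (suc k))
  mergeTop-after-σB-merged m k refl = begin
    eval (mergeTop m) (σB (suc m) (d (suc k))) ≡⟨ ≡.cong (eval (mergeTop m)) (σB-d≡ (suc k)) ⟩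
    eval (mergeTop m) (var (d (suc k)) ++ var (d (suc m))) ≡⟨ SBA.eval-++ (mergeTop m) (var (d (suc k))) (var (d (suc m))) ⟩
    eval (mergeTop m) (var (d (suc k))) ++ eval (mergeTop m) (var (d (suc m)))
      ≈⟨ ++-cong (≋-trans (SBA.eval-var (mergeTop m) (d (suc k))) (≋-trans (τ-then²-≡ (mergeA (oddIx m)) (killA (oddIx (suc m))) (d (suc k)) (τ-d k))
                    (-P-cong (eval-via-var (mergeA (oddIx m)) (killA (oddIx (suc m))) (evenIx k) (killA-other (evenIx≢oddIx {k} {suc m}))
                                           (mergeA-odd-other m (evenIx k) (evenIx≢evenIx (≢-< (ℕ.n<1+n k)))))
                             (eval-via-var (mergeA (oddIx m)) (killA (oddIx (suc m))) (oddIx m) (killA-other (oddIx≢oddIx (≢-< (ℕ.n<1+n m))))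
                                           (mergeA-odd-other m (oddIx m) (oddIx≢evenIx {m} {m}))))))
                 (≋-trans (SBA.eval-var (mergeTop m) (d (suc m))) (≋-trans (τ-then²-≡ (mergeA (oddIx m)) (killA (oddIx (suc m))) (d (suc m)) (τ-d m))
                    (-P-cong (eval-via-var (mergeA (oddIx m)) (killA (oddIx (suc m))) (evenIx m) (killA-other (evenIx≢oddIx {m} {suc m}))
                                           (mergeA-odd-next m))
                             (eval-via-[] (mergeA (oddIx m)) (killA (oddIx (suc m))) (oddIx (suc m)) (killA-self _))))) ⟩
    (var (evenIx k) -P var (oddIx m)) ++ (var (oddIx m) -P []) ≈⟨ [p-q]+[q-r]≋p-r (var (evenIx k)) (var (oddIx m)) [] ⟩
    var (evenIx k) -P []
      ≈⟨ ≋-sym (≋-trans (τ-then²-≡ (skipA (oddIx m)) (killA (oddIx m)) (d (suc k)) (τ-d k))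
                 (-P-cong (eval-via-var (skipA (oddIx m)) (killA (oddIx m)) (evenIx k) (killA-other (evenIx≢oddIx {k} {m}))
                                        (skipA-< (evenIx<oddIx (ℕ.n<1+n k))))
                          (eval-via-[] (skipA (oddIx m)) (killA (oddIx m)) (oddIx m) (killA-self _)))) ⟩
    skipTop m (d (suc k)) ∎

  mergeTop-after-σB : ∀ m x → InBD m x → eval (mergeTop m) (σB (suc m) x) ≋ skipTop m x
  mergeTop-after-σB m (inj₁ zero) (() , _)
  mergeTop-after-σB m (inj₂ zero) (() , _)
  mergeTop-after-σB m (inj₁ (suc k)) (_ , k<m) = eval-along (mergeTop m) (σB (suc m)) (b (suc k)) (σB-b< (s≤s k<m))
    (≋-trans (τ-then²-≡ (mergeA (oddIx m)) (killA (oddIx (suc m))) (b (suc k)) (τ-b k))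
      (≋-trans (-P-cong (eval-via-var (mergeA (oddIx m)) (killA (oddIx (suc m))) (oddIx k) (killA-other (oddIx≢oddIx (≢-< (ℕ.<-trans k<m (ℕ.n<1+n m)))))
                                      (mergeA-odd-other m (oddIx k) (oddIx≢evenIx {k} {m})))
                        (eval-via-var (mergeA (oddIx m)) (killA (oddIx (suc m))) (evenIx k) (killA-other (evenIx≢oddIx {k} {suc m}))
                                      (mergeA-odd-other m (evenIx k) (evenIx≢evenIx (≢-< k<m)))))
        (≋-sym (≋-trans (τ-then²-≡ (skipA (oddIx m)) (killA (oddIx m)) (b (suc k)) (τ-b k))
          (-P-cong (eval-via-var (skipA (oddIx m)) (killA (oddIx m)) (oddIx k) (killA-other (oddIx≢oddIx (≢-< k<m))) (skipA-< (oddIx-< k<m)))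
                   (eval-via-var (skipA (oddIx m)) (killA (oddIx m)) (evenIx k) (killA-other (evenIx≢oddIx {k} {m})) (skipA-< (evenIx<oddIx k<m))))))))
  mergeTop-after-σB m (inj₂ (suc k)) (_ , k<m) with ℕ.<-cmp (suc k) m
  ... | tri< lt _ _ = eval-along (mergeTop m) (σB (suc m)) (d (suc k)) (σB-d< (s≤s lt))
    (≋-trans (τ-then²-≡ (mergeA (oddIx m)) (killA (oddIx (suc m))) (d (suc k)) (τ-d k))
      (≋-trans (-P-cong (eval-via-var (mergeA (oddIx m)) (killA (oddIx (suc m))) (evenIx k) (killA-other (evenIx≢oddIx {k} {suc m}))
                                      (mergeA-odd-other m (evenIx k) (evenIx≢evenIx (≢-< k<m))))
                        (eval-via-var (mergeA (oddIx m)) (killA (oddIx (suc m))) (oddIx (suc k)) (killA-other (oddIx≢oddIx (≢-< (s≤s k<m))))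
                                      (mergeA-odd-other m (oddIx (suc k)) (oddIx≢evenIx {suc k} {m}))))
        (≋-sym (≋-trans (τ-then²-≡ (skipA (oddIx m)) (killA (oddIx m)) (d (suc k)) (τ-d k))
          (-P-cong (eval-via-var (skipA (oddIx m)) (killA (oddIx m)) (evenIx k) (killA-other (evenIx≢oddIx {k} {m})) (skipA-< (evenIx<oddIx k<m)))
                   (eval-via-var (skipA (oddIx m)) (killA (oddIx m)) (oddIx (suc k)) (killA-other (oddIx≢oddIx (≢-< lt))) (skipA-< (oddIx-< lt))))))))
  ... | tri> _ _ gt = ⊥-elim (ℕ.<-irrefl refl (ℕ.<-≤-trans gt k<m))
  ... | tri≈ _ e _ = mergeTop-after-σB-merged m k e

  killTop-kills-d : ∀ m → killTop m (d (suc m)) ≋ []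
  killTop-kills-d m = ≋-trans (τ-then²-≡ (killA (evenIx m)) (killA (oddIx (suc m))) (d (suc m)) (τ-d m))
    (-P-cong (eval-via-var (killA (evenIx m)) (killA (oddIx (suc m))) (evenIx m) (killA-other (evenIx≢oddIx {m} {suc m})) (killA-self (evenIx m)))
             (eval-via-[] (killA (evenIx m)) (killA (oddIx (suc m))) (oddIx (suc m)) (killA-self _)))

  killTop-after-σD : ∀ m x → InBD m x → eval (killTop m) (σD (suc m) x) ≋ τ x
  killTop-after-σD m (inj₁ zero) (() , _)
  killTop-after-σD m (inj₂ zero) (() , _)
  killTop-after-σD m (inj₁ (suc k)) (_ , k<m) = eval-along (killTop m) (σD (suc m)) (b (suc k)) (σD-b< (s≤s k<m))
    (≋-trans (τ-then²-≡ (killA (evenIx m)) (killA (oddIx (suc m))) (b (suc k)) (τ-b k))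
      (≋-trans (-P-cong (eval-via-var (killA (evenIx m)) (killA (oddIx (suc m))) (oddIx k) (killA-other (oddIx≢oddIx (≢-< (ℕ.<-trans k<m (ℕ.n<1+n m)))))
                                      (killA-other (oddIx≢evenIx {k} {m})))
                        (eval-via-var (killA (evenIx m)) (killA (oddIx (suc m))) (evenIx k) (killA-other (evenIx≢oddIx {k} {suc m}))
                                      (killA-other (evenIx≢evenIx (≢-< k<m)))))
        (≋-reflexive (≡.sym (τ-b k)))))
  killTop-after-σD m (inj₂ (suc k)) (_ , k<m) = eval-along (killTop m) (σD (suc m)) (d (suc k)) (σD-d< (s≤s k<m))
    (≋-trans (τ-then²-≡ (killA (evenIx m)) (killA (oddIx (suc m))) (d (suc k)) (τ-d k))
      (≋-trans (-P-cong (eval-via-var (killA (evenIx m)) (killA (oddIx (suc m))) (evenIx k) (killA-other (evenIx≢oddIx {k} {suc m}))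
                                      (killA-other (evenIx≢evenIx (≢-< k<m))))
                        (eval-via-var (killA (evenIx m)) (killA (oddIx (suc m))) (oddIx (suc k)) (killA-other (oddIx≢oddIx (≢-< (s≤s k<m))))
                                      (killA-other (oddIx≢evenIx {suc k} {m}))))
        (≋-reflexive (≡.sym (τ-d k)))))

  τ-uses : ∀ m x → InBD m x → UsesOnly ℕ._≟_ (InA (oddIx m)) (τ x)
  τ-uses m (inj₁ zero) (() , _)
  τ-uses m (inj₂ zero) (() , _)
  τ-uses m (inj₁ (suc k)) (_ , k≤m) = ≡.subst (UsesOnly ℕ._≟_ (InA (oddIx m))) (≡.sym (τ-b k))
    (uses--P (var (oddIx k)) (var (evenIx k)) (uses-var (oddIx k) (s≤s z≤n , ℕ.<⇒≤ (oddIx-< k≤m)))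
      (uses-var (evenIx k) (s≤s z≤n , ℕ.<⇒≤ (evenIx<oddIx k≤m))))
    where open LA.Support (InA (oddIx m)) (InA? (oddIx m))
  τ-uses m (inj₂ (suc k)) (_ , k≤m) = ≡.subst (UsesOnly ℕ._≟_ (InA (oddIx m))) (≡.sym (τ-d k))
    (uses--P (var (evenIx k)) (var (oddIx (suc k))) (uses-var (evenIx k) (s≤s z≤n , ℕ.<⇒≤ (evenIx<oddIx k≤m)))
      (uses-var (oddIx (suc k)) (s≤s z≤n , s≤s (double-≤ k≤m))))
    where open LA.Support (InA (oddIx m)) (InA? (oddIx m))

  killA-uses : ∀ m j → InA (oddIx m) j → UsesOnly ℕ._≟_ (InA (m + m)) (killA (oddIx m) j)
  killA-uses m j (j≥1 , j≤) with j ℕ.≟ oddIx m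
  ... | yes refl = ≡.subst (UsesOnly ℕ._≟_ (InA (m + m))) (≡.sym (killA-self (oddIx m))) (LA.Support.uses-[] (InA (m + m)) (InA? (m + m)))
  ... | no ne = ≡.subst (UsesOnly ℕ._≟_ (InA (m + m))) (≡.sym (killA-other ne))
       (LA.Support.uses-var (InA (m + m)) (InA? (m + m)) j (j≥1 , ℕ.≤-pred (ℕ.≤∧≢⇒< j≤ ne)))

  τ-deg : ∀ x → DegLe ℕ._≟_ 1 (τ x)
  τ-deg (inj₁ zero) = LA.Degree.deg-[] 1
  τ-deg (inj₂ zero) = LA.Degree.deg-[] 1
  τ-deg (inj₁ (suc i)) = LA.Degree.deg--P 1 (var (2 * suc i ∸ 1)) (var (2 * suc i)) (LA.Degree.deg-var (2 * suc i ∸ 1)) (LA.Degree.deg-var (2 * suc i))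
  τ-deg (inj₂ (suc i)) = LA.Degree.deg--P 1 (var (2 * suc i)) (var (suc (2 * suc i))) (LA.Degree.deg-var (2 * suc i)) (LA.Degree.deg-var (suc (2 * suc i)))

  killA-deg : ∀ K j → DegLe ℕ._≟_ 1 (killA K j)
  killA-deg K j with j ≡ᵇ K
  ... | true = LA.Degree.deg-[] 1
  ... | false = LA.Degree.deg-var j

  module Image (h : ℕ → Poly BD) (sol : SolNC' h) where
    private
      module SBB = Substitution _≟BD_ _≟BD_
      module CBAA = Composition _≟BD_ ℕ._≟_ ℕ._≟_
      module CBBA = Composition _≟BD_ _≟BD_ ℕ._≟_
      module CAAA = Composition ℕ._≟_ ℕ._≟_ ℕ._≟_

    uses-h : ∀ m → UsesOnly _≟BD_ (InBD m) (h m)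
    uses-h = proj₁ (proj₁ sol)

    eval-h-congˢ : ∀ m {σ σ' : BD → Poly ℕ} → (∀ x → InBD m x → σ x ≋ σ' x) → eval σ (h m) ≋ eval σ' (h m)
    eval-h-congˢ m = SBA.OnSupport.eval-congˢ-on (InBD m) (InBD? m) (h m) (uses-h m)

    eval-h-congˢ-BD : ∀ m {σ σ' : BD → Poly BD} → (∀ x → InBD m x → LB._≋_ (σ x) (σ' x)) → LB._≋_ (eval σ (h m)) (eval σ' (h m))
    eval-h-congˢ-BD m = SBB.OnSupport.eval-congˢ-on (InBD m) (InBD? m) (h m) (uses-h m)

    zeroD-relation : ∀ m i → 1 ≤ i → i ≤ suc m → LB._≋_ (eval (zeroAt (d i)) (h (suc m))) (eval (σD i) (h m))
    zeroD-relation m i i≥1 i≤ with i ℕ.≟ suc m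
    ... | yes refl = LB.≋-trans (LB.⟪ proj₁ (proj₂ (proj₂ sol)) m ⟫)
          (LB.≋-sym (LB.≋-trans (eval-h-congˢ-BD m fixed) (eval-var-id _≟BD_ (h m))))
      where
      fixed : ∀ x → InBD m x → LB._≋_ (σD (suc m) x) (var x)
      fixed (inj₁ k) (_ , k≤m) = LB.≋-reflexive (σD-b< (s≤s k≤m))
      fixed (inj₂ k) (_ , k≤m) = LB.≋-reflexive (σD-d< (s≤s k≤m))
    ... | no ne = LB.⟪ proj₁ (proj₂ sol) m i i≥1 (ℕ.≤∧≢⇒< i≤ ne) ⟫

    zeroB-relation : ∀ m i → 1 ≤ i → i ≤ suc m → LB._≋_ (eval (zeroAt (b i)) (h (suc m))) (eval (σB i) (h m))
    zeroB-relation m (suc zero) _ _ = LB.≋-trans (LB.⟪ proj₂ (proj₂ (proj₂ (proj₂ sol))) m ⟫) (LB.≋-sym (eval-h-congˢ-BD m shifted))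
      where
      shifted : ∀ x → InBD m x → LB._≋_ (σB 1 x) (shiftBD x)
      shifted (inj₁ k) (k≥1 , _) = LB.≋-reflexive (σB-b≥ k≥1)
      shifted (inj₂ k) (k≥1 , _) = LB.≋-reflexive (σB-d> k≥1)
    zeroB-relation m (suc (suc i)) _ i≤ = LB.⟪ proj₁ (proj₂ (proj₂ (proj₂ sol))) m (suc (suc i)) (s≤s (s≤s z≤n)) i≤ ⟫

    -- A substitution ρ that kills the letter y sees h (suc m) only through its specialisation at y = 0.
    relation-through-zero : ∀ m y (σ : BD → Poly BD) (ρ T : BD → Poly ℕ) → LB._≋_ (eval (zeroAt y) (h (suc m))) (eval σ (h m)) →
                            ρ y ≋ [] → (∀ x → InBD m x → eval ρ (σ x) ≋ T x) → eval ρ (h (suc m)) ≋ eval T (h m)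
    relation-through-zero m y σ ρ T rel ρy≋0 ρσ≋T = begin
      eval ρ (h (suc m)) ≈⟨ SBA.eval-congˢ (h (suc m)) kills-y ⟩
      eval (λ x → eval ρ (zeroAt y x)) (h (suc m)) ≈⟨ ≋-sym (CBBA.eval-∘ ρ (zeroAt y) (h (suc m))) ⟩
      eval ρ (eval (zeroAt y) (h (suc m))) ≈⟨ SBA.eval-cong ρ rel ⟩
      eval ρ (eval σ (h m)) ≈⟨ CBBA.eval-∘ ρ σ (h m) ⟩
      eval (λ x → eval ρ (σ x)) (h m) ≈⟨ eval-h-congˢ m ρσ≋T ⟩
      eval T (h m) ∎
      where
      kills-y : ∀ x → ρ x ≋ eval ρ (zeroAt y x)
      kills-y x with x ≟BD y
      ... | yes refl = ρy≋0
      ... | no _ = ≋-sym (SBA.eval-var ρ x)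

    merge-odd-relation : ∀ m j → j ≤ m → eval (mergeA (oddIx j)) (eval τ (h (suc m))) ≋ eval (skipA (oddIx j)) (eval τ (h m))
    merge-odd-relation m j j≤m = begin
      eval (mergeA (oddIx j)) (eval τ (h (suc m))) ≈⟨ CBAA.eval-∘ (mergeA (oddIx j)) τ (h (suc m)) ⟩
      eval (τ-then (mergeA (oddIx j))) (h (suc m))
        ≈⟨ relation-through-zero m (b (suc j)) (σB (suc j)) (τ-then (mergeA (oddIx j))) (τ-then (skipA (oddIx j)))
             (zeroB-relation m (suc j) (s≤s z≤n) (s≤s j≤m)) (MergeOdd.kills-b j) (λ x x∈ → MergeOdd.after-σB j x (proj₁ x∈)) ⟩
      eval (τ-then (skipA (oddIx j))) (h m) ≈⟨ ≋-sym (CBAA.eval-∘ (skipA (oddIx j)) τ (h m)) ⟩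
      eval (skipA (oddIx j)) (eval τ (h m)) ∎

    merge-even-relation : ∀ m j → j ≤ m → eval (mergeA (evenIx j)) (eval τ (h (suc m))) ≋ eval (skipA (evenIx j)) (eval τ (h m))
    merge-even-relation m j j≤m = begin
      eval (mergeA (evenIx j)) (eval τ (h (suc m))) ≈⟨ CBAA.eval-∘ (mergeA (evenIx j)) τ (h (suc m)) ⟩
      eval (τ-then (mergeA (evenIx j))) (h (suc m))
        ≈⟨ relation-through-zero m (d (suc j)) (σD (suc j)) (τ-then (mergeA (evenIx j))) (τ-then (skipA (evenIx j)))
             (zeroD-relation m (suc j) (s≤s z≤n) (s≤s j≤m)) (MergeEven.kills-d j) (λ x x∈ → MergeEven.after-σD j x (proj₁ x∈)) ⟩
      eval (τ-then (skipA (evenIx j))) (h m) ≈⟨ ≋-sym (CBAA.eval-∘ (skipA (evenIx j)) τ (h m)) ⟩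
      eval (skipA (evenIx j)) (eval τ (h m)) ∎

    merge-relation : ∀ m i → 1 ≤ i → i ≤ evenIx m → eval (mergeA i) (eval τ (h (suc m))) ≋ eval (skipA i) (eval τ (h m))
    merge-relation m i i≥1 i≤ with parity i
    merge-relation m .(zero + zero) () i≤ | even zero
    merge-relation m .(evenIx j) _ i≤ | even (suc j) = merge-even-relation m j (ℕ.≤-pred (double-≤⁻ {suc j} {suc m} i≤))
    merge-relation m .(oddIx j) _ i≤ | odd j = merge-odd-relation m j (ℕ.≤-pred (double-<⁻ {j} {suc m} i≤))

    merge-relation-killed : ∀ m i → 1 ≤ i → i ≤ m + m →
      eval (mergeA i) (eval (killA (oddIx (suc m))) (eval τ (h (suc m)))) ≋ eval (skipA i) (eval (killA (oddIx m)) (eval τ (h m)))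
    merge-relation-killed m i i≥1 i≤ = begin
      eval (mergeA i) (eval k₊ X) ≈⟨ CAAA.eval-∘ (mergeA i) k₊ X ⟩
      eval (λ j → eval (mergeA i) (k₊ j)) X ≈⟨ SAA.eval-congˢ X (mergeA-killA-comm i (oddIx (suc m)) (ℕ.≤-<-trans (s≤s i≤) (oddIx-< (ℕ.n<1+n m)))) ⟩
      eval (λ j → eval k₊ (mergeA i j)) X ≈⟨ ≋-sym (CAAA.eval-∘ k₊ (mergeA i) X) ⟩
      eval k₊ (eval (mergeA i) X) ≈⟨ SAA.eval-cong k₊ (merge-relation m i i≥1 (ℕ.≤-trans i≤ (ℕ.<⇒≤ (double-< (ℕ.n<1+n m))))) ⟩
      eval k₊ (eval (skipA i) Y) ≈⟨ CAAA.eval-∘ k₊ (skipA i) Y ⟩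
      eval (λ j → eval k₊ (skipA i j)) Y
        ≈⟨ SAA.eval-congˢ Y (≡.subst (λ K → ∀ j → eval (killA K) (skipA i j) ≋ eval (skipA i) (killA (oddIx m) j)) (2+oddIx m)
                                     (killA-skipA-comm i (oddIx m) (s≤s i≤))) ⟩
      eval (λ j → eval (skipA i) (killA (oddIx m) j)) Y ≈⟨ ≋-sym (CAAA.eval-∘ (skipA i) (killA (oddIx m)) Y) ⟩
      eval (skipA i) (eval (killA (oddIx m)) Y) ∎
      where
      k₊ = killA (oddIx (suc m))
      X = eval τ (h (suc m))
      Y = eval τ (h m)

    τ-then²-∘ : ∀ (σ₁ σ₂ : ℕ → Poly ℕ) m → eval σ₁ (eval σ₂ (eval τ (h m))) ≋ eval (τ-then² σ₁ σ₂) (h m)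
    τ-then²-∘ σ₁ σ₂ m = ≋-trans (SAA.eval-cong σ₁ (CBAA.eval-∘ σ₂ τ (h m))) (CBAA.eval-∘ σ₁ (τ-then σ₂) (h m))

    merge-relation-top : ∀ m →
      eval (mergeA (oddIx m)) (eval (killA (oddIx (suc m))) (eval τ (h (suc m)))) ≋ eval (skipA (oddIx m)) (eval (killA (oddIx m)) (eval τ (h m)))
    merge-relation-top m = ≋-trans (τ-then²-∘ (mergeA (oddIx m)) (killA (oddIx (suc m))) (suc m))
      (≋-trans (relation-through-zero m (b (suc m)) (σB (suc m)) (mergeTop m) (skipTop m)
                  (zeroB-relation m (suc m) (s≤s z≤n) ℕ.≤-refl) (mergeTop-kills-b m) (mergeTop-after-σB m))
               (≋-sym (τ-then²-∘ (skipA (oddIx m)) (killA (oddIx m)) m)))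

    killing-top-pair : ∀ m → eval (killA (evenIx m)) (eval (killA (oddIx (suc m))) (eval τ (h (suc m)))) ≋ eval τ (h m)
    killing-top-pair m = ≋-trans (τ-then²-∘ (killA (evenIx m)) (killA (oddIx (suc m))) (suc m))
      (relation-through-zero m (d (suc m)) (σD (suc m)) (killTop m) τ
         (zeroD-relation m (suc m) (s≤s z≤n) ℕ.≤-refl) (killTop-kills-d m) (killTop-after-σD m))

    uses-τh : ∀ m → UsesOnly ℕ._≟_ (InA (oddIx m)) (eval τ (h m))
    uses-τh m = SBA.OnSupport.uses-eval (InBD m) (InBD? m) (InA (oddIx m)) (InA? (oddIx m)) {τ} (h m) (uses-h m) (τ-uses m)

    uses-Φba : ∀ n → UsesOnly ℕ._≟_ (InA n) (Φba h n)
    uses-Φba n with parity n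
    ... | odd m = ≡.subst (UsesOnly ℕ._≟_ (InA (oddIx m))) (≡.sym (Φba-odd h m)) (uses-τh m)
    ... | even m = ≡.subst (UsesOnly ℕ._≟_ (InA (m + m))) (≡.sym (Φba-even h m))
          (SAA.OnSupport.uses-eval (InA (oddIx m)) (InA? (oddIx m)) (InA (m + m)) (InA? (m + m)) {killA (oddIx m)}
             (eval τ (h m)) (uses-τh m) (killA-uses m))

    deg-Φba : ∃ λ D → ∀ n → DegLe ℕ._≟_ D (Φba h n)
    deg-Φba = D , deg
      where
      D = proj₁ (proj₁ (proj₂ (proj₁ sol)))
      deg-h = proj₂ (proj₁ (proj₂ (proj₁ sol)))
      deg : ∀ n → DegLe ℕ._≟_ D (Φba h n)
      deg n with evenB n
      ... | true = SAA.deg-eval {killA (suc n)} D (eval τ (h ⌊ n /2⌋)) (SBA.deg-eval {τ} D (h ⌊ n /2⌋) (deg-h _) τ-deg) (killA-deg (suc n))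
      ... | false = SBA.deg-eval {τ} D (h ⌊ n /2⌋) (deg-h _) τ-deg

    stable : ∀ n → eval (killA (suc n)) (Φba h (suc n)) ≋ Φba h n
    stable n with parity n
    ... | even m = ≋-reflexive (≡.trans (≡.cong (eval (killA (oddIx m))) (Φba-odd h m)) (≡.sym (Φba-even h m)))
    ... | odd m = begin
      eval (killA (suc (oddIx m))) (Φba h (suc (oddIx m))) ≡⟨ ≡.cong (λ z → eval (killA z) (Φba h z)) (≡.sym (evenIx≡suc-oddIx m)) ⟩
      eval (killA (evenIx m)) (Φba h (evenIx m)) ≡⟨ ≡.cong (eval (killA (evenIx m))) (Φba-even h (suc m)) ⟩
      eval (killA (evenIx m)) (eval (killA (oddIx (suc m))) (eval τ (h (suc m)))) ≈⟨ killing-top-pair m ⟩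
      eval τ (h m) ≡⟨ ≡.sym (Φba-odd h m) ⟩
      Φba h (oddIx m) ∎

    merge-Φba : ∀ n i → 1 ≤ i → i < 2 + n → eval (mergeA i) (Φba h (2 + n)) ≋ eval (skipA i) (Φba h n)
    merge-Φba n i i≥1 i< with parity n
    ... | even m = begin
      eval (mergeA i) (Φba h (2 + (m + m))) ≡⟨ ≡.cong (λ z → eval (mergeA i) (Φba h z)) (2+double m) ⟩
      eval (mergeA i) (Φba h (evenIx m)) ≡⟨ ≡.cong (eval (mergeA i)) (Φba-even h (suc m)) ⟩
      eval (mergeA i) (eval (killA (oddIx (suc m))) (eval τ (h (suc m)))) ≈⟨ killed ⟩
      eval (skipA i) (eval (killA (oddIx m)) (eval τ (h m))) ≡⟨ ≡.cong (eval (skipA i)) (≡.sym (Φba-even h m)) ⟩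
      eval (skipA i) (Φba h (m + m)) ∎
      where
      killed : eval (mergeA i) (eval (killA (oddIx (suc m))) (eval τ (h (suc m)))) ≋ eval (skipA i) (eval (killA (oddIx m)) (eval τ (h m)))
      killed with i ℕ.≟ oddIx m
      ... | yes refl = merge-relation-top m
      ... | no ne = merge-relation-killed m i i≥1 (ℕ.≤-pred (ℕ.≤∧≢⇒< (ℕ.≤-pred i<) ne))
    ... | odd m = begin
      eval (mergeA i) (Φba h (2 + oddIx m)) ≡⟨ ≡.cong (λ z → eval (mergeA i) (Φba h z)) (2+oddIx m) ⟩
      eval (mergeA i) (Φba h (oddIx (suc m))) ≡⟨ ≡.cong (eval (mergeA i)) (Φba-odd h (suc m)) ⟩
      eval (mergeA i) (eval τ (h (suc m))) ≈⟨ merge-relation m i i≥1 (≡.subst (i ≤_) (≡.sym (evenIx≡suc-oddIx m)) (ℕ.≤-pred i<)) ⟩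
      eval (skipA i) (eval τ (h m)) ≡⟨ ≡.cong (eval (skipA i)) (≡.sym (Φba-odd h m)) ⟩
      eval (skipA i) (Φba h (oddIx m)) ∎

    solNC : SolNC (Φba h)
    solNC = (uses-Φba , deg-Φba , (λ n → ap (stable n))) , (λ n i i≥1 i< → ap (merge-Φba n i i≥1 i<))

module Morphisms {c ℓ} (R : CommutativeRing c ℓ) where

  open WithRing R
  open CommutativeRing R using (Carrier)
  open Polynomials R
  open Letters R
  module SAB = Substitution ℕ._≟_ _≟BD_
  module SBA = Substitution _≟BD_ ℕ._≟_
  module SAA = Substitution ℕ._≟_ ℕ._≟_
  open Differences _≟BD_ using ([p-q]-[p-[q+r]]≋r; [[r+p]-q]-[p-q]≋r)
  open SetoidReasoning LB.≋-setoid

  Φab-+ : ∀ P Q → Φab (P +S Q) ≈SBD (Φab P +S Φab Q)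
  Φab-+ P Q m = LB.ap (LB.≋-reflexive (SAB.eval-++ (σab m) (P _) (Q _)))

  Φab-· : ∀ k P → Φab (k ·S P) ≈SBD (k ·S Φab P)
  Φab-· k P m = LB.ap (SAB.eval-· (σab m) k (P _))

  Φab-* : ∀ P Q → Φab (P *S Q) ≈SBD (Φab P *S Φab Q)
  Φab-* P Q m = LB.ap (SAB.eval-*P (σab m) (P _) (Q _))

  Φab-1 : Φab 1S ≈SBD 1S
  Φab-1 m = LB.ap (SAB.eval-1P (σab m))

  Φba-+ : ∀ h g → Φba (h +S g) ≈SA (Φba h +S Φba g)
  Φba-+ h g n with evenB n
  ... | true = LA.ap (LA.≋-reflexive (≡.trans (≡.cong (eval (killA (suc n))) (SBA.eval-++ τ (h ⌊ n /2⌋) (g ⌊ n /2⌋)))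
                                              (SAA.eval-++ (killA (suc n)) (eval τ (h ⌊ n /2⌋)) (eval τ (g ⌊ n /2⌋)))))
  ... | false = LA.ap (LA.≋-reflexive (SBA.eval-++ τ (h ⌊ n /2⌋) (g ⌊ n /2⌋)))

  Φba-· : ∀ k h → Φba (k ·S h) ≈SA (k ·S Φba h)
  Φba-· k h n with evenB n
  ... | true = LA.ap (LA.≋-trans (SAA.eval-cong (killA (suc n)) (SBA.eval-· τ k (h ⌊ n /2⌋)))
                                 (SAA.eval-· (killA (suc n)) k (eval τ (h ⌊ n /2⌋))))
  ... | false = LA.ap (SBA.eval-· τ k (h ⌊ n /2⌋))

  Φba-* : ∀ h g → Φba (h *S g) ≈SA (Φba h *S Φba g)
  Φba-* h g n with evenB n
  ... | true = LA.ap (LA.≋-trans (SAA.eval-cong (killA (suc n)) (SBA.eval-*P τ (h ⌊ n /2⌋) (g ⌊ n /2⌋)))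
                                 (SAA.eval-*P (killA (suc n)) (eval τ (h ⌊ n /2⌋)) (eval τ (g ⌊ n /2⌋))))
  ... | false = LA.ap (SBA.eval-*P τ (h ⌊ n /2⌋) (g ⌊ n /2⌋))

  Φba-1 : Φba 1S ≈SA 1S
  Φba-1 n with evenB n
  ... | true = LA.ap (LA.≋-trans (SAA.eval-cong (killA (suc n)) (SBA.eval-1P τ)) (SAA.eval-1P (killA (suc n))))
  ... | false = LA.ap (SBA.eval-1P τ)

  -- σab m (a_{2k-1}) - σab m (a_{2k}) = b_k and σab m (a_{2k}) - σab m (a_{2k+1}) = d_k: adjacent windows differ in one letter.
  σab-inverts-τ : ∀ m x → InBD m x → LB._≋_ (eval (σab m) (τ x)) (var x)
  σab-inverts-τ m (inj₁ zero) (() , _)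
  σab-inverts-τ m (inj₂ zero) (() , _)
  σab-inverts-τ m (inj₁ (suc k)) _ = begin
    eval (σab m) (τ (b (suc k))) ≈⟨ eval-τ _≟BD_ (σab m) (b (suc k)) (τ-b k) ⟩
    σab m (oddIx k) -P σab m (evenIx k)
      ≡⟨ ≡.cong₂ _-P_ (σab-odd m k) (≡.trans (σab-even m k) (≡.cong (λ z → Dsum (suc k) m -P z) (sumP-snoc (λ t → var (b t)) 1 k (s≤s z≤n)))) ⟩
    (Dsum (suc k) m -P Bsum 1 k) -P (Dsum (suc k) m -P (Bsum 1 k ++ (var (b (suc k)) ++ [])))
      ≈⟨ [p-q]-[p-[q+r]]≋r (Dsum (suc k) m) (Bsum 1 k) (var (b (suc k)) ++ []) ⟩
    var (b (suc k)) ++ [] ≈⟨ LB.++-identityʳ (var (b (suc k))) ⟩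
    var (b (suc k)) ∎
  σab-inverts-τ m (inj₂ (suc k)) (_ , k<m) = begin
    eval (σab m) (τ (d (suc k))) ≈⟨ eval-τ _≟BD_ (σab m) (d (suc k)) (τ-d k) ⟩
    σab m (evenIx k) -P σab m (oddIx (suc k))
      ≡⟨ ≡.cong₂ _-P_ (≡.trans (σab-even m k) (≡.cong (λ z → z -P Bsum 1 (suc k)) (sumP-cons (λ t → var (d t)) (suc k) m k<m))) (σab-odd m (suc k)) ⟩
    ((var (d (suc k)) ++ Dsum (suc (suc k)) m) -P Bsum 1 (suc k)) -P (Dsum (suc (suc k)) m -P Bsum 1 (suc k))
      ≈⟨ [[r+p]-q]-[p-q]≋r (var (d (suc k))) (Dsum (suc (suc k)) m) (Bsum 1 (suc k)) ⟩
    var (d (suc k)) ∎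

  Φab∘Φba : ∀ h → SolNC' h → Φab (Φba h) ≈SBD h
  Φab∘Φba h sol m = LB.ap (begin
    Φab (Φba h) m ≡⟨ ≡.cong (λ z → eval (σab m) (Φba h (suc z))) (2*n≡n+n m) ⟩
    eval (σab m) (Φba h (oddIx m)) ≡⟨ ≡.cong (eval (σab m)) (Backward.Φba-odd R h m) ⟩
    eval (σab m) (eval τ (h m)) ≈⟨ Composition.eval-∘ _≟BD_ ℕ._≟_ _≟BD_ (σab m) τ (h m) ⟩
    eval (λ x → eval (σab m) (τ x)) (h m)
      ≈⟨ Substitution.OnSupport.eval-congˢ-on _≟BD_ _≟BD_ (InBD m) (InBD? m) (h m) (proj₁ (proj₁ sol) m) (σab-inverts-τ m) ⟩
    eval var (h m) ≈⟨ eval-var-id _≟BD_ (h m) ⟩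
    h m ∎)

  theorem :
      (∀ P → SolNC P → SolNC' (Φab P))
    × (∀ h → SolNC' h → SolNC (Φba h))
    × (∀ P Q → SolNC P → SolNC Q → Φab (P +S Q) ≈SBD (Φab P +S Φab Q))
    × (∀ (k : Carrier) P → SolNC P → Φab (k ·S P) ≈SBD (k ·S Φab P))
    × (∀ P Q → SolNC P → SolNC Q → Φab (P *S Q) ≈SBD (Φab P *S Φab Q))
    × (Φab 1S ≈SBD 1S)
    × (∀ h g → SolNC' h → SolNC' g → Φba (h +S g) ≈SA (Φba h +S Φba g))
    × (∀ (k : Carrier) h → SolNC' h → Φba (k ·S h) ≈SA (k ·S Φba h))
    × (∀ h g → SolNC' h → SolNC' g → Φba (h *S g) ≈SA (Φba h *S Φba g))
    × (Φba 1S ≈SA 1S)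
    × (∀ h → SolNC' h → Φab (Φba h) ≈SBD h)
    × (∀ h → SolNC' h → ∃ λ P → SolNC P × Φab P ≈SBD h)
  theorem = (λ P sol → Forward.Image.solNC' R P sol)
          , (λ h sol → Backward.Image.solNC R h sol)
          , (λ P Q _ _ → Φab-+ P Q)
          , (λ k P _ → Φab-· k P)
          , (λ P Q _ _ → Φab-* P Q)
          , Φab-1
          , (λ h g _ _ → Φba-+ h g)
          , (λ k h _ → Φba-· k h)
          , (λ h g _ _ → Φba-* h g)
          , Φba-1
          , Φab∘Φba
          , (λ h sol → Φba h , Backward.Image.solNC R h sol , Φab∘Φba h sol)

proposition6p1 : ∀ {c ℓ} (R : CommutativeRing c ℓ) →
  let open CommutativeRing R using (Carrier)
      open WithRing R
  in
  -- Φ_{a→b,d} maps Sol_NC into Sol_NC'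
    (∀ P → SolNC P → SolNC' (Φab P))
  -- Φ_{b,d→a} maps Sol_NC' into Sol_NC
  × (∀ h → SolNC' h → SolNC (Φba h))
  -- Φ_{a→b,d} is an algebra morphism
  × (∀ P Q → SolNC P → SolNC Q → Φab (P +S Q) ≈SBD (Φab P +S Φab Q))
  × (∀ (k : Carrier) P → SolNC P → Φab (k ·S P) ≈SBD (k ·S Φab P))
  × (∀ P Q → SolNC P → SolNC Q → Φab (P *S Q) ≈SBD (Φab P *S Φab Q))
  × (Φab 1S ≈SBD 1S)
  -- Φ_{b,d→a} is an algebra morphism
  × (∀ h g → SolNC' h → SolNC' g → Φba (h +S g) ≈SA (Φba h +S Φba g))
  × (∀ (k : Carrier) h → SolNC' h → Φba (k ·S h) ≈SA (k ·S Φba h))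
  × (∀ h g → SolNC' h → SolNC' g → Φba (h *S g) ≈SA (Φba h *S Φba g))
  × (Φba 1S ≈SA 1S)
  -- Φ_{a→b,d} ∘ Φ_{b,d→a} = Id on Sol_NC'
  × (∀ h → SolNC' h → Φab (Φba h) ≈SBD h)
  -- in particular Φ_{a→b,d} is surjective
  × (∀ h → SolNC' h → ∃ λ P → SolNC P × Φab P ≈SBD h)
proposition6p1 R = Morphisms.theorem R
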